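{- Let $n\geq3$ be odd and let $\sigma\in D_n$ be a reflection. Then (i) $\mathrm{fix}_{G_n}(\sigma) = 2^{(n+1)/2}-3\cdot2^{(n-1)/4}+1$ if $n\equiv1\pmod4$, and $\mathrm{fix}_{G_n}(\sigma) = 2^{(n+1)/2}-2^{(n+5)/4}+1$ if $n\equiv3\pmod 4$; (ii) for any $3\leq m\leq n$, $\mathrm{fix}_{G_{m,n}}(\sigma) = \binom{\lfloor n/2\rfloor}{\lfloor m/2\rfloor} - \binom{\lfloor n/4\rfloor}{\lfloor m/2\rfloor} - \binom{\lfloor (n+2)/4\rfloor}{m/2}$.
   Context: For $n\geq3$, let $T_n$ be the set of $n$-tuples $(a_1,\dots,a_n)$ with entries in $\{0,1\}$, positions regarded cyclically modulo $n$. A block of 0's of length $l$ is a sequence of $l$ cyclically consecutive positions (possibly wrapping around) all with entry $0$, not contained in a longer such sequence. With $k=\lfloor n/2\rfloor$, a block is bad if its length is at least $k-1$ ($n=2k$ even) or at least $k$ ($n=2k+1$ odd); a tuple is bad if it has a bad block (the all-zero tuple is bad), good otherwise. $G_n$ is the set of good tuples and $G_{m,n}$ the set of good tuples with exactly $m$ ones. $D_n$ is the dihedral group of permutations of $\{1,\dots,n\}$ consisting of the rotations $x\mapsto q+x \pmod n$ and reflections $x\mapsto q-x\pmod n$; it acts on $T_n$ by $\sigma\cdot(a_1,\dots,a_n)=(a_{\sigma^{ -1}(1)},\dots,a_{\sigma^{ -1}(n)})$, preserving $G_n$ and $G_{m,n}$. For a set $X$ and $\sigma\in D_n$, $\mathrm{fix}_X(\sigma)$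 is the number of $\mathbf a\in X$ with $\sigma\cdot\mathbf a=\mathbf a$. Binomial coefficients $\binom ab$ are $0$ unless $a,b$ are non-negative integers with $b\le a$ (so $\binom{x}{m/2}=0$ for odd $m$). -}

module Defs where

open import Data.Bool using (Bool; true; false; _∧_; _∨_; not; if_then_else_; T)
open import Data.Nat using (ℕ; zero; suc; _+_; _*_; _∸_; _/_; _%_; _≡ᵇ_; _≤ᵇ_)
open import Data.Nat.DivMod using (_mod_)
open import Data.Nat.Combinatorics using (_C_)
open import Data.Fin using (Fin; toℕ)
open import Data.Vec using (Vec; []; _∷_; lookup; tabulate)
open import Data.List using (List; []; _∷_; map; _++_; upTo; length; filter)
open import Data.Bool.ListAction using (any; all)
open import Relation.Binary.PropositionalEquality using (_≡_)
open import Relation.Nullary using (Dec)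
open import Relation.Nullary.Decidable using (_×-dec_)
open import Data.Vec.Properties using (≡-dec)
import Data.Bool.Properties as BoolP
open import Data.Bool.Properties using (T?)

-- n-tuples with entries in {0,1}: Vec Bool n, false = 0, true = 1.
-- Positions are 0,…,n-1 (a shift of 1,…,n; everything is mod n).
Tuple : ℕ → Set
Tuple n = Vec Bool n

allTuples : (n : ℕ) → List (Tuple n)
allTuples zero    = [] ∷ []
allTuples (suc n) = map (false ∷_) (allTuples n) ++ map (true ∷_) (allTuples n)

cyc : ∀ {n} → Tuple n → ℕ → Bool
cyc {zero}  _ _ = false
cyc {suc n} a j = lookup a (j mod suc n)

zerosFrom : ∀ {n} → Tuple n → ℕ → ℕ → Bool
zerosFrom a i l = all (λ j → not (cyc a (i + j))) (upTo l)

-- a block of 0's of length l starting at position i (1 ≤ l ≤ n):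
-- l cyclically consecutive zeros not contained in a longer such sequence.
-- For l < n this means both neighbouring positions i-1 and i+l carry a 1;
-- l = n is the all-zero tuple.
isBlock : ∀ {n} → Tuple n → ℕ → ℕ → Bool
isBlock {n} a i l =
  zerosFrom a i l ∧ (1 ≤ᵇ l) ∧ (l ≤ᵇ n) ∧
  ((l ≡ᵇ n) ∨ (cyc a (i + n ∸ 1) ∧ cyc a (i + l)))

badLen : ℕ → ℕ
badLen n = if n % 2 ≡ᵇ 0 then n / 2 ∸ 1 else n / 2

allZero : ∀ {n} → Tuple n → Bool
allZero {n} a = zerosFrom a 0 n

isBad : ∀ {n} → Tuple n → Bool
isBad {n} a =
  allZero a ∨
  any (λ i → any (λ l → (badLen n ≤ᵇ l) ∧ isBlock a i l) (upTo (suc n))) (upTo n)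

isGood : ∀ {n} → Tuple n → Bool
isGood a = not (isBad a)

ones : ∀ {n} → Tuple n → ℕ
ones [] = 0
ones (true ∷ a) = suc (ones a)
ones (false ∷ a) = ones a

-- Dihedral group D_n: rotations x ↦ q + x, reflections x ↦ q - x (mod n)
data Dihedral (n : ℕ) : Set where
  rot : Fin n → Dihedral n
  ref : Fin n → Dihedral n

perm : ∀ {n} → Dihedral n → ℕ → ℕ
perm {zero}  _       x = x
perm {suc n} (rot q) x = toℕ ((toℕ q + x) mod suc n)
perm {suc n} (ref q) x = toℕ ((toℕ q + suc n ∸ (x % suc n)) mod suc n)

inv : ∀ {n} → Dihedral n → Dihedral n
inv {zero}  σ       = σ
inv {suc n} (rot q) = rot ((suc n ∸ toℕ q) mod suc n)
inv {suc n} (ref q) = ref q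

act : ∀ {n} → Dihedral n → Tuple n → Tuple n
act σ a = tabulate (λ i → cyc a (perm (inv σ) (toℕ i)))

IsReflection : ∀ {n} → Dihedral n → Set
IsReflection {n} σ = Σ' (Fin n) (λ q → σ ≡ ref q)
  where
  open import Data.Product using () renaming (Σ to Σ')

fixedDec : ∀ {n} (σ : Dihedral n) (a : Tuple n) → Dec (act σ a ≡ a)
fixedDec σ a = ≡-dec BoolP._≟_ (act σ a) a

fixG : ∀ {n} → Dihedral n → ℕ
fixG {n} σ = length (filter (λ a → T? (isGood a) ×-dec fixedDec σ a) (allTuples n))

fixGm : ∀ {n} → ℕ → Dihedral n → ℕ
fixGm {n} m σ =
  length (filter (λ a → (T? (isGood a) ×-dec (ones a Data.Nat.≟ m)) ×-dec fixedDec σ a) (allTuples n))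
  where import Data.Nat

binomHalf : ℕ → ℕ → ℕ
binomHalf x m = if m % 2 ≡ᵇ 0 then x C (m / 2) else 0

-- Write k = A + B with A = ⌊n/4⌋ and B = ⌊(n+2)/4⌋, so that A ≤ B ≤ A + 1 and B ≥ 1.
-- The file first sets up sums ∑ over all Boolean vectors of a length (with Fubini, counting
-- along a section, and the counts 2ⁿ - 1 and C(n, j)) and arithmetic modulo N (module Cyclic).
-- The proof then has four ingredients, developed in this order.
--  * Badness (module Badness): for odd n a tuple is bad iff it has a run of k cyclically
--    consecutive zeros; a run lies inside the maximal block found by searching for the last 1
--    before it and the first 1 after it.
--  * Folding (module Folding): a reflection x ↦ q - x has a centre c with 2c ≡ q (mod n), and the
--    tuples it fixes are exactly the unfoldings of b ∈ Bool^{k+1}: position j carries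
--    b[dist (j - c)], where dist r = min (r, n - r).  Unfolding and restriction to the k + 1
--    positions c, …, c + k are inverse bijections, so sums over fixed tuples become sums over
--    Bool^{k+1} (∑-retract).
--  * For b = u ++ w with |u| = A + 1 and |w| = B, the unfolding is good iff u ≠ 0 and w ≠ 0
--    (module Goodness), and it has b₀ + 2·(ones of the rest of b) ones (module OnesOfUnfolding).
--  * Counting (module Counting): fix_G = (2^{A+1} - 1)(2^B - 1), and by inclusion–exclusion over
--    the pairs (u, w), fix_{G_m} = C(k, ⌊m/2⌋) - C(A, ⌊m/2⌋) - [m even] C(B, m/2).
-- The theorem follows by writing n as 4A + 1 or 4A + 3 and evaluating the floors.
module Submission where

open import Defs
open import Data.Bool using (Bool; true; false; T; not; _∧_; _∨_; if_then_else_)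
open import Data.Bool.Properties using (T-≡; T-not-≡; T-∧; T-∨; ¬-not; ∧-identityʳ; ∧-zeroʳ) renaming (_≟_ to _≟𝔹_)
open import Data.Bool.ListAction using (all; any)
open import Data.Nat using (ℕ; zero; suc; _+_; _*_; _∸_; _^_; _⊓_; _≤_; _<_; s≤s; z≤n; _%_; _/_; _≤ᵇ_; _≡ᵇ_; _<?_; _≤?_; NonZero)
open import Data.Nat.Properties
open import Data.Nat.DivMod using (_mod_; m%n%n≡m%n; [m+kn]%n≡m%n; m%n<n; %-distribˡ-+; m<n⇒m%n≡m; +-distrib-/-∣ʳ; m*n/n≡m; m<n⇒m/n≡0)
open import Data.Nat.Divisibility using (divides)
open import Data.Nat.Combinatorics using (_C_; nCk+nC[k+1]≡[n+1]C[k+1])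
open import Data.Nat.Tactic.RingSolver using (solve-∀)
open import Algebra.Properties.CommutativeSemigroup +-commutativeSemigroup using (interchange)
open import Data.Fin using (Fin; toℕ)
open import Data.Fin.Properties using (toℕ-injective; toℕ-fromℕ<; toℕ<n)
open import Data.Vec using (Vec; []; _∷_; _++_; lookup; tabulate)
open import Data.Vec.Properties using (≡-dec; lookup∘tabulate; tabulate-cong; tabulate∘lookup)
open import Data.List using (List; map; length; filter; upTo) renaming (_++_ to _++ₗ_; _∷_ to _∷ₗ_; [] to []ₗ)
open import Data.List.Properties using (filter-++; length-++)
open import Data.List.Relation.Unary.All as All using ()
open import Data.List.Relation.Unary.All.Properties using (all⁺; all⁻; ¬Any⇒All¬)
open import Data.List.Relation.Unary.Any using (any?)
open import Data.List.Relation.Unary.Any.Properties using (any⁺; any⁻)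
open import Data.List.Membership.Propositional using (lose; find)
open import Data.List.Membership.Propositional.Properties using (∈-upTo⁺; ∈-upTo⁻)
open import Data.Product using (∃; ∃₂; _,_; _×_; proj₁; proj₂)
open import Data.Sum using (_⊎_; inj₁; inj₂)
open import Data.Empty using (⊥-elim)
open import Function using (_∘_; Equivalence)
open import Level using (0ℓ)
open import Relation.Binary.PropositionalEquality
open import Relation.Binary.Bundles using (Setoid)
import Relation.Binary.Reasoning.Setoid as SetoidReasoning
open import Relation.Nullary using (Dec; does; yes; no; ¬_; contradiction)
open import Relation.Nullary.Decidable using (dec-true)
open import Relation.Unary using (Pred; Decidable)
open Equivalence using (to; from)

𝟙 : Bool → ℕ
𝟙 true  = 1
𝟙 false = 0

𝟙-∧ : ∀ x y → 𝟙 (x ∧ y) ≡ 𝟙 x * 𝟙 y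
𝟙-∧ true  y = sym (+-identityʳ (𝟙 y))
𝟙-∧ false y = refl

∑ : (n : ℕ) → (Vec Bool n → ℕ) → ℕ
∑ zero    f = f []
∑ (suc n) f = ∑ n (λ v → f (false ∷ v)) + ∑ n (λ v → f (true ∷ v))

∑-cong : ∀ n {f g : Vec Bool n → ℕ} → (∀ v → f v ≡ g v) → ∑ n f ≡ ∑ n g
∑-cong zero    f≗g = f≗g []
∑-cong (suc n) f≗g = cong₂ _+_ (∑-cong n (λ v → f≗g (false ∷ v))) (∑-cong n (λ v → f≗g (true ∷ v)))

∑-zero : ∀ n → ∑ n (λ _ → 0) ≡ 0
∑-zero zero    = refl
∑-zero (suc n) = cong₂ _+_ (∑-zero n) (∑-zero n)

∑-one : ∀ n → ∑ n (λ _ → 1) ≡ 2 ^ n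
∑-one zero    = refl
∑-one (suc n) = cong₂ _+_ (∑-one n) (trans (∑-one n) (sym (+-identityʳ (2 ^ n))))

∑-+ : ∀ n (f g : Vec Bool n → ℕ) → ∑ n (λ v → f v + g v) ≡ ∑ n f + ∑ n g
∑-+ zero    f g = refl
∑-+ (suc n) f g =
  trans (cong₂ _+_ (∑-+ n (λ v → f (false ∷ v)) (λ v → g (false ∷ v)))
                   (∑-+ n (λ v → f (true ∷ v)) (λ v → g (true ∷ v))))
        (interchange (∑ n (λ v → f (false ∷ v))) _ _ _)

∑-*ˡ : ∀ n c (f : Vec Bool n → ℕ) → ∑ n (λ v → c * f v) ≡ c * ∑ n f
∑-*ˡ zero    c f = refl
∑-*ˡ (suc n) c f =
  trans (cong₂ _+_ (∑-*ˡ n c (λ v → f (false ∷ v))) (∑-*ˡ n c (λ v → f (true ∷ v))))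
        (sym (*-distribˡ-+ c (∑ n (λ v → f (false ∷ v))) _))

∑-swap : ∀ n m (g : Vec Bool n → Vec Bool m → ℕ) →
  ∑ n (λ a → ∑ m (λ b → g a b)) ≡ ∑ m (λ b → ∑ n (λ a → g a b))
∑-swap zero    m g = refl
∑-swap (suc n) m g =
  trans (cong₂ _+_ (∑-swap n m (λ a → g (false ∷ a))) (∑-swap n m (λ a → g (true ∷ a))))
        (sym (∑-+ m (λ b → ∑ n (λ a → g (false ∷ a) b)) (λ b → ∑ n (λ a → g (true ∷ a) b))))

∑-++ : ∀ p q (f : Vec Bool (p + q) → ℕ) → ∑ (p + q) f ≡ ∑ p (λ u → ∑ q (λ w → f (u ++ w)))
∑-++ zero    q f = refl
∑-++ (suc p) q f = cong₂ _+_ (∑-++ p q (λ v → f (false ∷ v))) (∑-++ p q (λ v → f (true ∷ v)))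

∑-product : ∀ p q (f : Vec Bool p → ℕ) (g : Vec Bool q → ℕ) →
  ∑ p (λ u → ∑ q (λ w → f u * g w)) ≡ ∑ p f * ∑ q g
∑-product p q f g = begin
    ∑ p (λ u → ∑ q (λ w → f u * g w))   ≡⟨ ∑-cong p (λ u → ∑-*ˡ q (f u) g) ⟩
    ∑ p (λ u → f u * ∑ q g)             ≡⟨ ∑-cong p (λ u → *-comm (f u) (∑ q g)) ⟩
    ∑ p (λ u → ∑ q g * f u)             ≡⟨ ∑-*ˡ p (∑ q g) f ⟩
    ∑ q g * ∑ p f                       ≡⟨ *-comm (∑ q g) (∑ p f) ⟩
    ∑ p f * ∑ q g                       ∎
  where open ≡-Reasoning

_≟ᵛ_ : ∀ {n} (a b : Vec Bool n) → Dec (a ≡ b)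
_≟ᵛ_ = ≡-dec _≟𝔹_

∑-delta : ∀ n (v : Vec Bool n) (c : ℕ) → ∑ n (λ a → if does (a ≟ᵛ v) then c else 0) ≡ c
∑-delta zero    []          c = refl
∑-delta (suc n) (false ∷ v) c = trans (cong₂ _+_ (∑-delta n v c) (∑-zero n)) (+-identityʳ c)
∑-delta (suc n) (true ∷ v)  c = cong₂ _+_ (∑-zero n) (∑-delta n v c)

does-⇔ : {P Q : Set} → (P → Q) → (Q → P) → (p? : Dec P) (q? : Dec Q) → does p? ≡ does q?
does-⇔ f g (yes p) (yes q) = refl
does-⇔ f g (yes p) (no ¬q) = ⊥-elim (¬q (f p))
does-⇔ f g (no ¬p) (yes q) = ⊥-elim (¬p (g q))
does-⇔ f g (no ¬p) (no ¬q) = refl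

if-const : ∀ (x : Bool) (c : ℕ) → (if x then c else c) ≡ c
if-const true  c = refl
if-const false c = refl

∑-retract : ∀ n m (e : Vec Bool m → Vec Bool n) (r : Vec Bool n → Vec Bool m) (χ : Vec Bool n → ℕ) →
  (∀ b → r (e b) ≡ b) → (∀ a → χ a ≢ 0 → e (r a) ≡ a) → ∑ n χ ≡ ∑ m (λ b → χ (e b))
∑-retract n m e r χ r∘e off-image = begin
    ∑ n χ                                       ≡⟨ ∑-cong n spread ⟩
    ∑ n (λ a → ∑ m (λ b → δ a b (χ a)))          ≡⟨ ∑-swap n m _ ⟩
    ∑ m (λ b → ∑ n (λ a → δ a b (χ a)))          ≡⟨ ∑-cong m collect ⟩
    ∑ m (λ b → χ (e b))                          ∎
  where
  open ≡-Reasoning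
  δ : Vec Bool n → Vec Bool m → ℕ → ℕ
  δ a b c = if does (a ≟ᵛ e b) then c else 0

  -- χ a is spread over the (at most one) b with e b = a, namely b = r a
  spread : ∀ a → χ a ≡ ∑ m (λ b → δ a b (χ a))
  spread a with χ a in χa
  ... | zero  = sym (trans (∑-cong m (λ b → if-const (does (a ≟ᵛ e b)) 0)) (∑-zero m))
  ... | suc c = sym (trans (∑-cong m (λ b → cong (λ x → if x then suc c else 0) (same b)))
                           (∑-delta m (r a) (suc c)))
    where
    e∘r : e (r a) ≡ a
    e∘r = off-image a (λ χa≡0 → 0≢1+n (trans (sym χa≡0) χa))
    same : ∀ b → does (a ≟ᵛ e b) ≡ does (b ≟ᵛ r a)
    same b = does-⇔ (λ a≡eb → trans (sym (r∘e b)) (cong r (sym a≡eb)))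
                    (λ b≡ra → trans (sym e∘r) (cong e (sym b≡ra)))
                    (a ≟ᵛ e b) (b ≟ᵛ r a)

  collect : ∀ b → ∑ n (λ a → δ a b (χ a)) ≡ χ (e b)
  collect b = trans (∑-cong n at-eb) (∑-delta n (e b) (χ (e b)))
    where
    at-eb : ∀ a → δ a b (χ a) ≡ δ a b (χ (e b))
    at-eb a with a ≟ᵛ e b
    ... | yes a≡eb = cong χ a≡eb
    ... | no  _    = refl

length-filter-++ : ∀ {A : Set} {P : Pred A 0ℓ} (P? : Decidable P) (xs ys : List A) →
  length (filter P? (xs ++ₗ ys)) ≡ length (filter P? xs) + length (filter P? ys)
length-filter-++ P? xs ys = trans (cong length (filter-++ P? xs ys)) (length-++ (filter P? xs))

length-filter-map : ∀ {A B : Set} {P : Pred B 0ℓ} (P? : Decidable P) (f : A → B) (xs : List A) →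
  length (filter P? (map f xs)) ≡ length (filter (λ x → P? (f x)) xs)
length-filter-map P? f []ₗ      = refl
length-filter-map P? f (x ∷ₗ xs) with does (P? (f x))
... | true  = cong suc (length-filter-map P? f xs)
... | false = length-filter-map P? f xs

count-allTuples : ∀ n {P : Pred (Vec Bool n) 0ℓ} (P? : Decidable P) →
  length (filter P? (allTuples n)) ≡ ∑ n (λ a → 𝟙 (does (P? a)))
count-allTuples zero    P? with does (P? [])
... | true  = refl
... | false = refl
count-allTuples (suc n) P? =
  trans (length-filter-++ P? (map (false ∷_) (allTuples n)) _)
        (cong₂ _+_ (trans (length-filter-map P? (false ∷_) (allTuples n)) (count-allTuples n (λ a → P? (false ∷ a))))
                   (trans (length-filter-map P? (true ∷_) (allTuples n)) (count-allTuples n (λ a → P? (true ∷ a)))))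

nz : ∀ {n} → Vec Bool n → Bool
nz []      = false
nz (x ∷ v) = x ∨ nz v

∑-nz : ∀ n → ∑ n (λ v → 𝟙 (nz v)) + 1 ≡ 2 ^ n
∑-nz zero    = refl
∑-nz (suc n) = begin
    ∑ n (λ v → 𝟙 (nz v)) + ∑ n (λ _ → 1) + 1   ≡⟨ +-assoc (∑ n (λ v → 𝟙 (nz v))) _ 1 ⟩
    ∑ n (λ v → 𝟙 (nz v)) + (∑ n (λ _ → 1) + 1) ≡⟨ cong (∑ n (λ v → 𝟙 (nz v)) +_) (+-comm (∑ n (λ _ → 1)) 1) ⟩
    ∑ n (λ v → 𝟙 (nz v)) + (1 + ∑ n (λ _ → 1)) ≡⟨ sym (+-assoc (∑ n (λ v → 𝟙 (nz v))) 1 _) ⟩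
    ∑ n (λ v → 𝟙 (nz v)) + 1 + ∑ n (λ _ → 1)   ≡⟨ cong₂ _+_ (∑-nz n) (∑-one n) ⟩
    2 ^ n + 2 ^ n                               ≡⟨ cong (2 ^ n +_) (sym (+-identityʳ (2 ^ n))) ⟩
    2 ^ suc n                                   ∎
  where open ≡-Reasoning

∑-at-zero : ∀ n (g : ℕ → ℕ) → ∑ n (λ w → 𝟙 (not (nz w)) * g (ones w)) ≡ g 0
∑-at-zero zero    g = +-identityʳ (g 0)
∑-at-zero (suc n) g = trans (cong₂ _+_ (∑-at-zero n g) (∑-zero n)) (+-identityʳ (g 0))

∑-ones : ∀ n j → ∑ n (λ v → 𝟙 (ones v ≡ᵇ j)) ≡ n C j
∑-ones zero    zero    = refl
∑-ones zero    (suc j) = refl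
∑-ones (suc n) zero    = cong₂ _+_ (∑-ones n 0) (∑-zero n)
∑-ones (suc n) (suc j) =
  trans (cong₂ _+_ (∑-ones n (suc j)) (∑-ones n j))
        (trans (+-comm (n C suc j) (n C j)) (nCk+nC[k+1]≡[n+1]C[k+1] n j))

ones-++ : ∀ {m p} (u : Vec Bool m) (w : Vec Bool p) → ones (u ++ w) ≡ ones u + ones w
ones-++ []          w = refl
ones-++ (true ∷ u)  w = cong suc (ones-++ u w)
ones-++ (false ∷ u) w = ones-++ u w

module Cyclic (n₀ : ℕ) where

  N : ℕ
  N = suc n₀

  -- Congruence modulo N (a record so that both sides can be inferred).
  infix 4 _≋_
  record _≋_ (x y : ℕ) : Set where
    constructor mod-eq
    field mod-≡ : x % N ≡ y % N

  ≡⇒≋ : ∀ {x y} → x ≡ y → x ≋ y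
  ≡⇒≋ x≡y = mod-eq (cong (_% N) x≡y)

  ≋-sym : ∀ {x y} → x ≋ y → y ≋ x
  ≋-sym (mod-eq e) = mod-eq (sym e)

  ≋-trans : ∀ {x y z} → x ≋ y → y ≋ z → x ≋ z
  ≋-trans (mod-eq e) (mod-eq f) = mod-eq (trans e f)

  ≋-setoid : Setoid _ _
  ≋-setoid = record
    { Carrier = ℕ ; _≈_ = _≋_
    ; isEquivalence = record { refl = ≡⇒≋ refl ; sym = ≋-sym ; trans = ≋-trans } }

  module ≋-Reasoning = SetoidReasoning ≋-setoid

  ≋-+ : ∀ {x x′ y y′} → x ≋ x′ → y ≋ y′ → x + y ≋ x′ + y′
  ≋-+ {x} {x′} {y} {y′} (mod-eq e) (mod-eq f) = mod-eq (begin
    (x + y) % N               ≡⟨ %-distribˡ-+ x y N ⟩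
    (x % N + y % N) % N       ≡⟨ cong₂ (λ u v → (u + v) % N) e f ⟩
    (x′ % N + y′ % N) % N     ≡⟨ %-distribˡ-+ x′ y′ N ⟨
    (x′ + y′) % N             ∎)
    where open ≡-Reasoning

  ≋-+ˡ : ∀ x {y y′} → y ≋ y′ → x + y ≋ x + y′
  ≋-+ˡ x = ≋-+ (≡⇒≋ {x} refl)

  ≋-+ʳ : ∀ {x x′} y → x ≋ x′ → x + y ≋ x′ + y
  ≋-+ʳ y x≋x′ = ≋-+ x≋x′ (≡⇒≋ {y} refl)

  ≋-multiple : ∀ x c → x + c * N ≋ x
  ≋-multiple x c = mod-eq ([m+kn]%n≡m%n x c N)

  ≋-N : ∀ x → x + N ≋ x
  ≋-N x = ≋-trans (≡⇒≋ (cong (x +_) (sym (+-identityʳ N)))) (≋-multiple x 1)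

  ≋-% : ∀ x → x % N ≋ x
  ≋-% x = mod-eq (m%n%n≡m%n x N)

  ≋-inverse : ∀ z → ∃ λ w → z + w ≋ 0
  ≋-inverse z = N ∸ z % N , (begin
      z + (N ∸ z % N)         ≈⟨ ≋-+ʳ (N ∸ z % N) (≋-sym (≋-% z)) ⟩
      z % N + (N ∸ z % N)     ≡⟨ m+[n∸m]≡n (<⇒≤ (m%n<n z N)) ⟩
      N                       ≈⟨ ≋-N 0 ⟩
      0                       ∎)
    where open ≋-Reasoning

  ≋-cancelʳ : ∀ x y z → x + z ≋ y + z → x ≋ y
  ≋-cancelʳ x y z x+z≋y+z with ≋-inverse z
  ... | w , z+w≋0 = begin
      x                ≡⟨ +-identityʳ x ⟨
      x + 0            ≈⟨ ≋-+ˡ x (≋-sym z+w≋0) ⟩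
      x + (z + w)      ≡⟨ +-assoc x z w ⟨
      x + z + w        ≈⟨ ≋-+ʳ w x+z≋y+z ⟩
      y + z + w        ≡⟨ +-assoc y z w ⟩
      y + (z + w)      ≈⟨ ≋-+ˡ y z+w≋0 ⟩
      y + 0            ≡⟨ +-identityʳ y ⟩
      y                ∎
    where open ≋-Reasoning

  ≋-canonical : ∀ {x y} → x < N → y < N → x ≋ y → x ≡ y
  ≋-canonical x<N y<N (mod-eq e) = trans (sym (m<n⇒m%n≡m x<N)) (trans e (m<n⇒m%n≡m y<N))

  ≋-sum-zero : ∀ {x y} → x < N → y < N → x + y ≋ 0 → (x ≡ 0 × y ≡ 0) ⊎ x + y ≡ N
  ≋-sum-zero {x} {y} x<N y<N x+y≋0 with x + y <? N
  ... | yes x+y<N = inj₁ (m+n≡0⇒m≡0 x sum≡0 , m+n≡0⇒n≡0 x sum≡0)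
    where
    sum≡0 : x + y ≡ 0
    sum≡0 = ≋-canonical x+y<N (s≤s z≤n) x+y≋0
  ... | no  x+y≮N = inj₂ (trans (sym N+f≡x+y) (trans (cong (N +_) f≡0) (+-identityʳ N)))
    where
    f : ℕ
    f = x + y ∸ N
    N+f≡x+y : N + f ≡ x + y
    N+f≡x+y = m+[n∸m]≡n (≮⇒≥ x+y≮N)
    f<N : f < N
    f<N = +-cancelˡ-< N f N (subst (_< N + N) (sym N+f≡x+y) (+-mono-< x<N y<N))
    f≡0 : f ≡ 0
    f≡0 = ≋-canonical f<N (s≤s z≤n) (begin
        f          ≈⟨ ≋-sym (≋-trans (≡⇒≋ (+-comm N f)) (≋-N f)) ⟩
        N + f      ≡⟨ N+f≡x+y ⟩
        x + y      ≈⟨ x+y≋0 ⟩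
        0          ∎)
      where open ≋-Reasoning

  cyc-≋ : ∀ (a : Tuple N) {x y} → x ≋ y → cyc a x ≡ cyc a y
  cyc-≋ a (mod-eq e) = cong (lookup a) (toℕ-injective (trans (toℕ-fromℕ< _) (trans e (sym (toℕ-fromℕ< _)))))

  cyc-lookup : ∀ (a : Tuple N) (i : Fin N) → cyc a (toℕ i) ≡ lookup a i
  cyc-lookup a i = cong (lookup a) (toℕ-injective (trans (toℕ-fromℕ< _) (m<n⇒m%n≡m (toℕ<n i))))

  cyc-tabulate : ∀ (f : ℕ → Bool) → (∀ {x y} → x ≋ y → f x ≡ f y) →
    ∀ j → cyc (tabulate {n = N} (λ i → f (toℕ i))) j ≡ f j
  cyc-tabulate f f-periodic j =
    trans (lookup∘tabulate (λ i → f (toℕ i)) (j mod N)) (trans (cong f (toℕ-fromℕ< _)) (f-periodic (≋-% j)))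

quotient : ∀ r x d .{{_ : NonZero d}} → r < d → (r + x * d) / d ≡ x
quotient r x d r<d = begin
    (r + x * d) / d      ≡⟨ +-distrib-/-∣ʳ r {x * d} {d} (divides x refl) ⟩
    r / d + x * d / d    ≡⟨ cong₂ _+_ (m<n⇒m/n≡0 r<d) (m*n/n≡m x d) ⟩
    x                    ∎
  where open ≡-Reasoning

remainder : ∀ r x d .{{_ : NonZero d}} → r < d → (r + x * d) % d ≡ r
remainder r x d r<d = trans ([m+kn]%n≡m%n r x d) (m<n⇒m%n≡m r<d)

badLen-odd : ∀ k → badLen (suc (k + k)) ≡ k
badLen-odd k = begin
    badLen (suc (k + k))                                            ≡⟨ cong badLen (odd k) ⟩
    (if (1 + k * 2) % 2 ≡ᵇ 0 then (1 + k * 2) / 2 ∸ 1 else (1 + k * 2) / 2)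
      ≡⟨ cong (λ r → if r ≡ᵇ 0 then (1 + k * 2) / 2 ∸ 1 else (1 + k * 2) / 2) (remainder 1 k 2 (s≤s (s≤s z≤n))) ⟩
    (1 + k * 2) / 2                                                 ≡⟨ quotient 1 k 2 (s≤s (s≤s z≤n)) ⟩
    k                                                               ∎
  where
  open ≡-Reasoning
  odd : ∀ k → suc (k + k) ≡ 1 + k * 2
  odd = solve-∀

all-upTo⁺ : ∀ (f : ℕ → Bool) {l} → T (all f (upTo l)) → ∀ {j} → j < l → T (f j)
all-upTo⁺ f t j<l = All.lookup (all⁺ f _ t) (∈-upTo⁺ j<l)

all-upTo⁻ : ∀ (f : ℕ → Bool) {l} → (∀ {j} → j < l → T (f j)) → T (all f (upTo l))
all-upTo⁻ f h = all⁻ f (All.tabulate (h ∘ ∈-upTo⁻))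

any-upTo⁺ : ∀ (f : ℕ → Bool) {l j} → j < l → T (f j) → T (any f (upTo l))
any-upTo⁺ f j<l t = any⁺ f (lose (∈-upTo⁺ j<l) t)

any-upTo⁻ : ∀ (f : ℕ → Bool) l → T (any f (upTo l)) → ∃ λ j → j < l × T (f j)
any-upTo⁻ f l t with find (any⁻ f (upTo l) t)
... | j , j∈ , fj = j , ∈-upTo⁻ j∈ , fj

least : ∀ {P : ℕ → Set} → Decidable P → ∀ {t₀} → P t₀ → ∃ λ φ → P φ × (∀ {t} → t < φ → ¬ P t)
least P? p with P? 0
... | yes p0 = 0 , p0 , λ ()
least P? {zero}   p | no ¬p0 = contradiction p ¬p0
least P? {suc t₀} p | no ¬p0 with least (P? ∘ suc) p
... | φ , pφ , below = suc φ , pφ , λ { {zero} _ → ¬p0 ; {suc t} (s≤s t<φ) → below t<φ }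

greatest : ∀ {P : ℕ → Set} → Decidable P → ∀ M {t₀} → t₀ ≤ M → P t₀ →
  ∃ λ g → g ≤ M × P g × (∀ {t} → g < t → t ≤ M → ¬ P t)
greatest P? M t₀≤M p with P? M
... | yes pM = M , ≤-refl , pM , λ M<t t≤M → contradiction t≤M (<⇒≱ M<t)
greatest {P} P? zero    t₀≤0 p | no ¬pM = contradiction (subst P (n≤0⇒n≡0 t₀≤0) p) ¬pM
greatest {P} P? (suc M) {t₀} t₀≤M+1 p | no ¬pM with t₀ ≟ suc M
... | yes refl = contradiction p ¬pM
... | no t₀≢ with greatest P? M (<⇒≤pred (≤∧≢⇒< t₀≤M+1 t₀≢)) p
... | g , g≤M , pg , above = g , m≤n⇒m≤1+n g≤M , pg , above′
  where
  above′ : ∀ {t} → g < t → t ≤ suc M → ¬ P t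
  above′ {t} g<t t≤M+1 with t ≟ suc M
  ... | yes refl = ¬pM
  ... | no t≢ = above g<t (<⇒≤pred (≤∧≢⇒< t≤M+1 t≢))

false≢true : false ≢ true
false≢true ()

module Badness (n₀ : ℕ) where
  open Cyclic n₀

  ZeroRun : Tuple N → ℕ → ℕ → Set
  ZeroRun a s L = ∀ {j} → j < L → cyc a (s + j) ≡ false

  zerosFrom⇒run : ∀ a i l → T (zerosFrom a i l) → ZeroRun a i l
  zerosFrom⇒run a i l t j<l = to T-not-≡ (all-upTo⁺ (λ j → not (cyc a (i + j))) t j<l)

  run⇒zerosFrom : ∀ a i l → ZeroRun a i l → T (zerosFrom a i l)
  run⇒zerosFrom a i l run = all-upTo⁻ (λ j → not (cyc a (i + j))) (from T-not-≡ ∘ run)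

  longBlock : Tuple N → ℕ → ℕ → Bool
  longBlock a i l = (badLen N ≤ᵇ l) ∧ isBlock a i l

  hasLongBlock : Tuple N → Bool
  hasLongBlock a = any (λ i → any (longBlock a i) (upTo (suc N))) (upTo N)

  isBlock-intro : ∀ a i l → ZeroRun a i l → 1 ≤ l → l ≤ N →
    cyc a (i + n₀) ≡ true → cyc a (i + l) ≡ true → T (isBlock a i l)
  isBlock-intro a i l run 1≤l l≤N one-before one-after =
    from (T-∧ {zerosFrom a i l}) (run⇒zerosFrom a i l run ,
    from (T-∧ {1 ≤ᵇ l}) (≤⇒≤ᵇ 1≤l ,
    from (T-∧ {l ≤ᵇ N}) (≤⇒≤ᵇ l≤N ,
    from (T-∨ {l ≡ᵇ N}) (inj₂ (from (T-∧ {cyc a (i + N ∸ 1)} {cyc a (i + l)})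
      (from T-≡ (trans (cong (cyc a) (cong (_∸ 1) (+-suc i n₀))) one-before) , from T-≡ one-after))))))

  bad⇒run : ∀ a → badLen N ≤ N → T (isBad a) → ∃ λ s → ZeroRun a s (badLen N)
  bad⇒run a L≤N bad with to (T-∨ {allZero a} {hasLongBlock a}) bad
  ... | inj₁ all-zero = 0 , λ j<L → zerosFrom⇒run a 0 N all-zero (<-≤-trans j<L L≤N)
  ... | inj₂ has-block with any-upTo⁻ (λ i → any (longBlock a i) (upTo (suc N))) N has-block
  ... | i , _ , t with any-upTo⁻ (longBlock a i) (suc N) t
  ... | l , _ , t′ with to (T-∧ {badLen N ≤ᵇ l} {isBlock a i l}) t′
  ... | L≤l , block = i , λ j<L →
    zerosFrom⇒run a i l (proj₁ (to (T-∧ {zerosFrom a i l}) block)) (<-≤-trans j<L (≤ᵇ⇒≤ _ _ L≤l))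

  one-at? : ∀ (a : Tuple N) x → Decidable (λ t → cyc a (x + t) ≡ true)
  one-at? a x t = cyc a (x + t) ≟𝔹 true

  seen-from : ∀ (a : Tuple N) s {p} → cyc a p ≡ true → ∃ λ t → t ≤ n₀ × cyc a (s + t) ≡ true
  seen-from a s {p} one with ≋-inverse s
  ... | w , s+w≋0 = (w + p) % N , <⇒≤pred (m%n<n (w + p) N) , trans (cyc-≋ a s+t≋p) one
    where
    open ≋-Reasoning
    s+t≋p : s + (w + p) % N ≋ p
    s+t≋p = begin
      s + (w + p) % N   ≈⟨ ≋-+ˡ s (≋-% (w + p)) ⟩
      s + (w + p)       ≡⟨ +-assoc s w p ⟨
      s + w + p         ≈⟨ ≋-+ʳ p s+w≋0 ⟩
      p                 ∎

  -- Around a run of L ≥ 1 zeros at s there is a maximal block of length ≥ L: it starts just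
  -- after the last 1 at some s + g, g ≤ n₀, and ends just before the next 1.
  module BlockAround (a : Tuple N) (L : ℕ) (1≤L : 1 ≤ L) (s : ℕ) (run : ZeroRun a s L)
                     (g : ℕ) (g≤n₀ : g ≤ n₀) (one-g : cyc a (s + g) ≡ true)
                     (after-g : ∀ {t} → g < t → t ≤ n₀ → ¬ cyc a (s + t) ≡ true) where

    δ : ℕ
    δ = n₀ ∸ g

    g+δ≡n₀ : g + δ ≡ n₀
    g+δ≡n₀ = m+[n∸m]≡n g≤n₀

    start : ℕ
    start = s + suc g

    cyc-start : ∀ j → cyc a (start + j) ≡ cyc a (s + (suc g + j))
    cyc-start j = cong (cyc a) (+-assoc s (suc g) j)

    -- δ zeros up to the end of the period, then the L zeros of the run
    zeros-after : ∀ {j} → j < δ + L → cyc a (start + j) ≡ false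
    zeros-after {j} j<δ+L with j <? δ
    ... | yes j<δ = trans (cyc-start j) (¬-not (after-g (s≤s (m≤m+n g j)) bound))
      where
      bound : suc g + j ≤ n₀
      bound = ≤-trans (≤-reflexive (sym (+-suc g j))) (≤-trans (+-monoʳ-≤ g j<δ) (≤-reflexive g+δ≡n₀))
    ... | no  j≮δ = trans (cyc-start j) (trans (cyc-≋ a (≋-+ˡ s wrap)) (run j′<L))
      where
      j′ : ℕ
      j′ = j ∸ δ
      δ+j′≡j : δ + j′ ≡ j
      δ+j′≡j = m+[n∸m]≡n (≮⇒≥ j≮δ)
      j′<L : j′ < L
      j′<L = +-cancelˡ-< δ j′ L (subst (_< δ + L) (sym δ+j′≡j) j<δ+L)
      wrap : suc g + j ≋ j′
      wrap = begin
        suc g + j          ≡⟨ cong (suc g +_) δ+j′≡j ⟨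
        suc g + (δ + j′)   ≡⟨ +-assoc (suc g) δ j′ ⟨
        suc (g + δ) + j′   ≡⟨ cong (λ x → suc x + j′) g+δ≡n₀ ⟩
        N + j′             ≡⟨ +-comm N j′ ⟩
        j′ + N             ≈⟨ ≋-N j′ ⟩
        j′                 ∎
        where open ≋-Reasoning

    -- one full turn after the start we are back at the last 1
    one-at-n₀ : cyc a (start + n₀) ≡ true
    one-at-n₀ = trans (cyc-start n₀) (trans (cyc-≋ a (≋-+ˡ s (≋-trans (≡⇒≋ (sym (+-suc g n₀))) (≋-N g)))) one-g)

    cyc-start% : ∀ j → cyc a (start % N + j) ≡ cyc a (start + j)
    cyc-start% j = cyc-≋ a (≋-+ʳ j (≋-% start))

    -- the block ends at the first 1 after the start
    maximal-block : ∃ λ l → l ≤ n₀ × L ≤ l × T (isBlock a (start % N) l)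
    maximal-block with least (one-at? a start) one-at-n₀
    ... | φ , one-φ , before-φ = φ , φ≤n₀ , L≤φ ,
          isBlock-intro a (start % N) φ
            (λ {j} j<φ → trans (cyc-start% j) (¬-not (before-φ j<φ)))
            (≤-trans 1≤L L≤φ) (m≤n⇒m≤1+n φ≤n₀) (trans (cyc-start% n₀) one-at-n₀) (trans (cyc-start% φ) one-φ)
      where
      φ≤n₀ : φ ≤ n₀
      φ≤n₀ = ≮⇒≥ (λ n₀<φ → before-φ n₀<φ one-at-n₀)
      δ+L≤φ : δ + L ≤ φ
      δ+L≤φ = ≮⇒≥ (λ φ<δ+L → false≢true (trans (sym (zeros-after φ<δ+L)) one-φ))
      L≤φ : L ≤ φ
      L≤φ = ≤-trans (m≤n+m L δ) δ+L≤φ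

  run⇒bad : ∀ a s → 1 ≤ badLen N → ZeroRun a s (badLen N) → T (isBad a)
  run⇒bad a s 1≤L run with any? (λ p → cyc a p ≟𝔹 true) (upTo N)
  ... | no  no-one = from (T-∨ {allZero a} {hasLongBlock a}) (inj₁ (run⇒zerosFrom a 0 N
          (λ j<N → ¬-not (All.lookup (¬Any⇒All¬ _ no-one) (∈-upTo⁺ j<N)))))
  ... | yes some-one with find some-one
  ... | p , _ , one with seen-from a s {p} one
  ... | t , t≤n₀ , one-t with greatest (one-at? a s) n₀ t≤n₀ one-t
  ... | g , g≤n₀ , one-g , after-g with BlockAround.maximal-block a (badLen N) 1≤L s run g g≤n₀ one-g after-g
  ... | l , l≤n₀ , L≤l , block =
    from (T-∨ {allZero a} {hasLongBlock a}) (inj₂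
      (any-upTo⁺ (λ i → any (longBlock a i) (upTo (suc N))) (m%n<n (s + suc g) N)
        (any-upTo⁺ (longBlock a ((s + suc g) % N)) (s≤s (m≤n⇒m≤1+n l≤n₀))
          (from (T-∧ {badLen N ≤ᵇ l} {isBlock a ((s + suc g) % N) l}) (≤⇒≤ᵇ L≤l , block)))))

-- Entry j of a vector, read as false beyond its length.
at : ∀ {m} → Vec Bool m → ℕ → Bool
at []       _       = false
at (x ∷ xs) zero    = x
at (x ∷ xs) (suc j) = at xs j

at-lookup : ∀ {m} (b : Vec Bool m) (j : Fin m) → at b (toℕ j) ≡ lookup b j
at-lookup (x ∷ b) Fin.zero    = refl
at-lookup (x ∷ b) (Fin.suc j) = at-lookup b j

at-tabulate : ∀ {m} (f : ℕ → Bool) {j} → j < m → at (tabulate {n = m} (λ i → f (toℕ i))) j ≡ f j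
at-tabulate {suc m} f {zero}  _         = refl
at-tabulate {suc m} f {suc j} (s≤s j<m) = at-tabulate (λ i → f (suc i)) j<m

at-++ˡ : ∀ {m p} (u : Vec Bool m) (w : Vec Bool p) {j} → j < m → at (u ++ w) j ≡ at u j
at-++ˡ (x ∷ u) w {zero}  _         = refl
at-++ˡ (x ∷ u) w {suc j} (s≤s j<m) = at-++ˡ u w j<m

at-++ʳ : ∀ {m p} (u : Vec Bool m) (w : Vec Bool p) t → at (u ++ w) (m + t) ≡ at w t
at-++ʳ []      w t = refl
at-++ʳ (x ∷ u) w t = at-++ʳ u w t

-- A reflection of the N-cycle, N = 2k + 1, fixes a tuple iff the tuple is the "unfolding"
-- of its k + 1 entries starting at the centre c of the reflection (2c ≡ q mod N).
module Folding (k : ℕ) where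
  open Cyclic (k + k) public

  dist : ℕ → ℕ
  dist r = r ⊓ (N ∸ r)

  dist≤k : ∀ r → dist r ≤ k
  dist≤k r with r ≤? k
  ... | yes r≤k = ≤-trans (m⊓n≤m r (N ∸ r)) r≤k
  ... | no  r≰k = ≤-trans (m⊓n≤n r (N ∸ r)) (≤-trans (∸-monoʳ-≤ N (≰⇒> r≰k)) (≤-reflexive (m+n∸m≡n k k)))

  dist-small : ∀ {r} → r ≤ k → dist r ≡ r
  dist-small {r} r≤k = m≤n⇒m⊓n≡m (begin
      r          ≤⟨ r≤k ⟩
      k          ≤⟨ n≤1+n k ⟩
      suc k      ≡⟨ m+n∸n≡m (suc k) k ⟨
      N ∸ k      ≤⟨ ∸-monoʳ-≤ N r≤k ⟩
      N ∸ r      ∎)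
    where open ≤-Reasoning

  dist-sym : ∀ {x y} → x + y ≡ N → dist x ≡ dist y
  dist-sym {x} {y} x+y≡N = begin
      x ⊓ (N ∸ x)    ≡⟨ cong (λ z → x ⊓ (z ∸ x)) (sym x+y≡N) ⟩
      x ⊓ (x + y ∸ x) ≡⟨ cong (x ⊓_) (m+n∸m≡n x y) ⟩
      x ⊓ y          ≡⟨ ⊓-comm x y ⟩
      y ⊓ x          ≡⟨ cong (y ⊓_) (m+n∸n≡m x y) ⟨
      y ⊓ (x + y ∸ y) ≡⟨ cong (λ z → y ⊓ (z ∸ y)) x+y≡N ⟩
      y ⊓ (N ∸ y)    ∎
    where open ≡-Reasoning

  mirror : Vec Bool (suc k) → ℕ → Bool
  mirror b t = at b (dist (t % N))

  mirror-≋ : ∀ b {x y} → x ≋ y → mirror b x ≡ mirror b y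
  mirror-≋ b (mod-eq e) = cong (λ r → at b (dist r)) e

  mirror-small : ∀ b {t} → t ≤ k → mirror b t ≡ at b t
  mirror-small b {t} t≤k =
    cong (at b) (trans (cong dist (m<n⇒m%n≡m (s≤s (≤-trans t≤k (m≤m+n k k))))) (dist-small t≤k))

  mirror-even : ∀ b {u v} → u + v ≋ 0 → mirror b u ≡ mirror b v
  mirror-even b {u} {v} u+v≋0
    with ≋-sum-zero (m%n<n u N) (m%n<n v N) (≋-trans (≋-+ (≋-% u) (≋-% v)) u+v≋0)
  ... | inj₁ (u%≡0 , v%≡0) = cong (λ r → at b (dist r)) (trans u%≡0 (sym v%≡0))
  ... | inj₂ sum≡N         = cong (at b) (dist-sym sum≡N)

  mirror-opposite : ∀ b u v → u + v ≡ N → mirror b u ≡ mirror b v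
  mirror-opposite b u v u+v≡N = mirror-even b {u} {v} (≋-trans (≡⇒≋ u+v≡N) (≋-N 0))

  N+N≋0 : N + N ≋ 0
  N+N≋0 = ≋-trans (≋-N N) (≋-N 0)

  reflect-≋ : ∀ (q : Fin N) {x} → x < N → perm (ref q) x + x ≋ toℕ q
  reflect-≋ q {x} x<N = begin
      perm (ref q) x + x                 ≡⟨ cong (_+ x) (toℕ-fromℕ< _) ⟩
      (toℕ q + N ∸ x % N) % N + x        ≈⟨ ≋-+ʳ x (≋-% _) ⟩
      toℕ q + N ∸ x % N + x              ≡⟨ cong (λ z → toℕ q + N ∸ z + x) (m<n⇒m%n≡m x<N) ⟩
      toℕ q + N ∸ x + x                  ≡⟨ m∸n+n≡m (≤-trans (<⇒≤ x<N) (m≤n+m N (toℕ q))) ⟩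
      toℕ q + N                          ≈⟨ ≋-N (toℕ q) ⟩
      toℕ q                              ∎
    where open ≋-Reasoning

  -- Every reflection has a centre c, 2c ≡ q (mod N): take c = q(k+1) mod N, as 2(k+1) = N + 1.
  centre : ∀ q → ∃₂ λ c d → c + d ≡ N × c + c ≋ q
  centre q = c , N ∸ c , m+[n∸m]≡n (<⇒≤ (m%n<n (q * suc k) N)) , (begin
      c + c                    ≈⟨ ≋-+ (≋-% (q * suc k)) (≋-% (q * suc k)) ⟩
      q * suc k + q * suc k    ≡⟨ twice q k ⟩
      q + q * N                ≈⟨ ≋-multiple q q ⟩
      q                        ∎)
    where
    open ≋-Reasoning
    c : ℕ
    c = (q * suc k) % N
    twice : ∀ q k → q * suc k + q * suc k ≡ q + q * suc (k + k)
    twice = solve-∀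

  -- The reflection x ↦ q - x with centre c; d = N - c plays the role of -c.
  module Reflection (q : Fin N) (c d : ℕ) (c+d≡N : c + d ≡ N) (2c≋q : c + c ≋ toℕ q) where

    -- the tuple whose entry at position j is b[dist (j - c)]
    unfold : Vec Bool (suc k) → Tuple N
    unfold b = tabulate (λ i → mirror b (toℕ i + d))

    restrict : Tuple N → Vec Bool (suc k)
    restrict a = tabulate (λ j → cyc a (c + toℕ j))

    cyc-unfold : ∀ b j → cyc (unfold b) j ≡ mirror b (j + d)
    cyc-unfold b = cyc-tabulate (λ j → mirror b (j + d)) (λ x≋y → mirror-≋ b (≋-+ʳ d x≋y))

    around : ∀ j → c + j + d ≋ j
    around j = begin
        c + j + d      ≡⟨ rearrange c j d ⟩
        j + (c + d)    ≡⟨ cong (j +_) c+d≡N ⟩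
        j + N          ≈⟨ ≋-N j ⟩
        j              ∎
      where
      open ≋-Reasoning
      rearrange : ∀ c j d → c + j + d ≡ j + (c + d)
      rearrange = solve-∀

    restrict-unfold : ∀ b → restrict (unfold b) ≡ b
    restrict-unfold b = trans (tabulate-cong entry) (tabulate∘lookup b)
      where
      entry : ∀ j → cyc (unfold b) (c + toℕ j) ≡ lookup b j
      entry j = begin
          cyc (unfold b) (c + toℕ j)   ≡⟨ cyc-unfold b (c + toℕ j) ⟩
          mirror b (c + toℕ j + d)     ≡⟨ mirror-≋ b (around (toℕ j)) ⟩
          mirror b (toℕ j)             ≡⟨ mirror-small b (<⇒≤pred (toℕ<n j)) ⟩
          at b (toℕ j)                 ≡⟨ at-lookup b j ⟩
          lookup b j                   ∎
        where open ≡-Reasoning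

    unfold-fixed : ∀ b → act (ref q) (unfold b) ≡ unfold b
    unfold-fixed b = tabulate-cong entry
      where
      entry : ∀ i → cyc (unfold b) (perm (ref q) (toℕ i)) ≡ mirror b (toℕ i + d)
      entry i = trans (cyc-unfold b x) (mirror-even b {x + d} {toℕ i + d} opposite)
        where
        x : ℕ
        x = perm (ref q) (toℕ i)
        rearrange : ∀ x i c d → x + d + (i + d) + (c + c) ≡ (x + i) + ((c + d) + (c + d))
        rearrange = solve-∀
        opposite : x + d + (toℕ i + d) ≋ 0
        opposite = ≋-cancelʳ _ 0 (c + c) (begin
          x + d + (toℕ i + d) + (c + c)        ≡⟨ rearrange x (toℕ i) c d ⟩
          (x + toℕ i) + ((c + d) + (c + d))    ≡⟨ cong (λ z → (x + toℕ i) + (z + z)) c+d≡N ⟩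
          (x + toℕ i) + (N + N)                ≈⟨ ≋-+ (reflect-≋ q (toℕ<n i)) N+N≋0 ⟩
          toℕ q + 0                            ≡⟨ +-identityʳ (toℕ q) ⟩
          toℕ q                                ≈⟨ ≋-sym 2c≋q ⟩
          c + c                                ∎)
          where open ≋-Reasoning

    fixed-mirror : ∀ (a : Tuple N) → act (ref q) a ≡ a → ∀ (i : Fin N) → cyc a (perm (ref q) (toℕ i)) ≡ cyc a (toℕ i)
    fixed-mirror a fixed i = trans (sym (lookup∘tabulate (λ j → cyc a (perm (ref q) (toℕ j))) i))
                                   (trans (cong (λ v → lookup v i) fixed) (sym (cyc-lookup a i)))

    -- With ρ = (i + d) mod N ≡ i - c, the position c + ρ is i itself …
    centre-near : ∀ (i : Fin N) → c + (toℕ i + d) % N ≋ toℕ i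
    centre-near i = begin
        c + (toℕ i + d) % N    ≈⟨ ≋-+ˡ c (≋-% (toℕ i + d)) ⟩
        c + (toℕ i + d)        ≡⟨ +-assoc c (toℕ i) d ⟨
        c + toℕ i + d          ≈⟨ around (toℕ i) ⟩
        toℕ i                  ∎
      where open ≋-Reasoning

    -- … and the position c + (N - ρ) is the mirror image q - i of i.
    centre-far : ∀ (i : Fin N) → c + (N ∸ (toℕ i + d) % N) ≋ perm (ref q) (toℕ i)
    centre-far i = ≋-cancelʳ _ _ (toℕ i) (≋-trans X+i≋q (≋-sym (reflect-≋ q (toℕ<n i))))
      where
      open ≋-Reasoning
      ρ : ℕ
      ρ = (toℕ i + d) % N
      X : ℕ
      X = c + (N ∸ ρ)
      X+i+d≋c : X + toℕ i + d ≋ c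
      X+i+d≋c = begin
        X + toℕ i + d            ≡⟨ +-assoc X (toℕ i) d ⟩
        X + (toℕ i + d)          ≈⟨ ≋-+ˡ X (≋-sym (≋-% (toℕ i + d))) ⟩
        c + (N ∸ ρ) + ρ          ≡⟨ +-assoc c (N ∸ ρ) ρ ⟩
        c + (N ∸ ρ + ρ)          ≡⟨ cong (c +_) (m∸n+n≡m (<⇒≤ (m%n<n (toℕ i + d) N))) ⟩
        c + N                    ≈⟨ ≋-N c ⟩
        c                        ∎
      q+d≋c : toℕ q + d ≋ c
      q+d≋c = begin
        toℕ q + d                ≈⟨ ≋-+ʳ d (≋-sym 2c≋q) ⟩
        c + c + d                ≡⟨ +-assoc c c d ⟩
        c + (c + d)              ≡⟨ cong (c +_) c+d≡N ⟩
        c + N                    ≈⟨ ≋-N c ⟩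
        c                        ∎
      X+i≋q : X + toℕ i ≋ toℕ q
      X+i≋q = ≋-cancelʳ _ _ d (≋-trans X+i+d≋c (≋-sym q+d≋c))

    -- In a fixed tuple, position c + dist ρ carries the entry of position i,
    -- as dist ρ is either ρ or N - ρ.
    centre-entry : ∀ (a : Tuple N) → act (ref q) a ≡ a → ∀ (i : Fin N) → cyc a (c + dist ((toℕ i + d) % N)) ≡ cyc a (toℕ i)
    centre-entry a fixed i with ⊓-sel ((toℕ i + d) % N) (N ∸ (toℕ i + d) % N)
    ... | inj₁ dist≡ρ   = cyc-≋ a (≋-trans (≡⇒≋ (cong (c +_) dist≡ρ)) (centre-near i))
    ... | inj₂ dist≡N∸ρ = trans (cyc-≋ a (≋-trans (≡⇒≋ (cong (c +_) dist≡N∸ρ)) (centre-far i))) (fixed-mirror a fixed i)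

    fixed⇒unfold-restrict : ∀ a → act (ref q) a ≡ a → unfold (restrict a) ≡ a
    fixed⇒unfold-restrict a fixed = trans (tabulate-cong entry) (tabulate∘lookup a)
      where
      open ≡-Reasoning
      entry : ∀ i → mirror (restrict a) (toℕ i + d) ≡ lookup a i
      entry i = begin
          mirror (restrict a) (toℕ i + d)             ≡⟨ at-tabulate (λ j → cyc a (c + j)) (s≤s (dist≤k _)) ⟩
          cyc a (c + dist ((toℕ i + d) % N))         ≡⟨ centre-entry a fixed i ⟩
          cyc a (toℕ i)                              ≡⟨ cyc-lookup a i ⟩
          lookup a i                                 ∎

sumBelow : ℕ → (ℕ → ℕ) → ℕ
sumBelow zero    f = 0
sumBelow (suc n) f = f 0 + sumBelow n (λ i → f (suc i))

sumBelow-cong : ∀ n {f g : ℕ → ℕ} → (∀ {i} → i < n → f i ≡ g i) → sumBelow n f ≡ sumBelow n g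
sumBelow-cong zero    f≗g = refl
sumBelow-cong (suc n) f≗g = cong₂ _+_ (f≗g (s≤s z≤n)) (sumBelow-cong n (λ i<n → f≗g (s≤s i<n)))

sumBelow-last : ∀ n (f : ℕ → ℕ) → sumBelow (suc n) f ≡ sumBelow n f + f n
sumBelow-last zero    f = +-comm (f 0) 0
sumBelow-last (suc n) f = trans (cong (f 0 +_) (sumBelow-last n (λ i → f (suc i)))) (sym (+-assoc (f 0) _ _))

sumBelow-+ : ∀ m n (f : ℕ → ℕ) → sumBelow (m + n) f ≡ sumBelow m f + sumBelow n (λ i → f (m + i))
sumBelow-+ zero    n f = refl
sumBelow-+ (suc m) n f = trans (cong (f 0 +_) (sumBelow-+ m n (λ i → f (suc i)))) (sym (+-assoc (f 0) _ _))

sumBelow-reverse : ∀ k (f : ℕ → ℕ) → sumBelow k (λ i → f (k ∸ i)) ≡ sumBelow k (λ i → f (suc i))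
sumBelow-reverse zero    f = refl
sumBelow-reverse (suc k) f = begin
    f (suc k) + sumBelow k (λ i → f (k ∸ i))        ≡⟨ cong (f (suc k) +_) (sumBelow-reverse k f) ⟩
    f (suc k) + sumBelow k (λ i → f (suc i))        ≡⟨ +-comm (f (suc k)) _ ⟩
    sumBelow k (λ i → f (suc i)) + f (suc k)        ≡⟨ sumBelow-last k (λ i → f (suc i)) ⟨
    sumBelow (suc k) (λ i → f (suc i))              ∎
  where open ≡-Reasoning

sumBelow-period : ∀ N (h : ℕ → ℕ) → (∀ x → h (x + N) ≡ h x) → ∀ d → sumBelow N (λ i → h (i + d)) ≡ sumBelow N h
sumBelow-period N h periodic zero    = sumBelow-cong N (λ {i} _ → cong h (+-identityʳ i))
sumBelow-period zero    h periodic (suc d) = refl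
sumBelow-period (suc n) h periodic (suc d) = begin
    sumBelow (suc n) (λ i → h (i + suc d))          ≡⟨ sumBelow-cong (suc n) (λ {i} _ → cong h (+-suc i d)) ⟩
    sumBelow (suc n) (λ i → h′ (suc i))             ≡⟨ sumBelow-last n (λ i → h′ (suc i)) ⟩
    sumBelow n (λ i → h′ (suc i)) + h′ (suc n)      ≡⟨ cong (sumBelow n (λ i → h′ (suc i)) +_) (trans (cong h (+-comm (suc n) d)) (periodic d)) ⟩
    sumBelow n (λ i → h′ (suc i)) + h′ 0            ≡⟨ +-comm _ (h′ 0) ⟩
    sumBelow (suc n) h′                             ≡⟨ sumBelow-period (suc n) h periodic d ⟩
    sumBelow (suc n) h                              ∎
  where
  open ≡-Reasoning
  h′ : ℕ → ℕ
  h′ i = h (i + d)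

ones-tabulate : ∀ n (f : ℕ → Bool) → ones (tabulate {n = n} (λ i → f (toℕ i))) ≡ sumBelow n (λ i → 𝟙 (f i))
ones-tabulate zero    f = refl
ones-tabulate (suc n) f with f 0
... | true  = cong suc (ones-tabulate n (λ i → f (suc i)))
... | false = ones-tabulate n (λ i → f (suc i))

ones-at : ∀ {m} (v : Vec Bool m) → ones v ≡ sumBelow m (λ i → 𝟙 (at v i))
ones-at []          = refl
ones-at (true ∷ v)  = cong suc (ones-at v)
ones-at (false ∷ v) = ones-at v

module OnesOfUnfolding (k : ℕ) where
  open Folding k

  -- Over one period, mirror (x ∷ b′) shows x once and every entry of b′ twice.
  ones-mirror : ∀ x (b′ : Vec Bool k) → sumBelow N (λ i → 𝟙 (mirror (x ∷ b′) i)) ≡ 𝟙 x + (ones b′ + ones b′)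
  ones-mirror x b′ = cong (𝟙 x +_) (trans (sumBelow-+ k k (λ i → 𝟙 (mirror b (suc i)))) (cong₂ _+_ rising falling))
    where
    b : Vec Bool (suc k)
    b = x ∷ b′
    rising : sumBelow k (λ i → 𝟙 (mirror b (suc i))) ≡ ones b′
    rising = trans (sumBelow-cong k (λ i<k → cong 𝟙 (mirror-small b i<k))) (sym (ones-at b′))
    opposite : ∀ {i} → i < k → suc (k + i) + (k ∸ i) ≡ N
    opposite {i} i<k = cong suc (trans (+-assoc k i (k ∸ i)) (cong (k +_) (m+[n∸m]≡n (<⇒≤ i<k))))
    falling : sumBelow k (λ i → 𝟙 (mirror b (suc (k + i)))) ≡ ones b′
    falling = begin
        sumBelow k (λ i → 𝟙 (mirror b (suc (k + i))))
      ≡⟨ sumBelow-cong k (λ {i} i<k → cong 𝟙 (trans (mirror-opposite b _ (k ∸ i) (opposite i<k)) (mirror-small b (m∸n≤m k i)))) ⟩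
        sumBelow k (λ i → 𝟙 (at b (k ∸ i)))
      ≡⟨ sumBelow-reverse k (λ j → 𝟙 (at b j)) ⟩
        sumBelow k (λ i → 𝟙 (at b′ i))
      ≡⟨ ones-at b′ ⟨
        ones b′
      ∎
      where open ≡-Reasoning

  module _ (q : Fin N) (c d : ℕ) (c+d≡N : c + d ≡ N) (2c≋q : c + c ≋ toℕ q) where
    open Reflection q c d c+d≡N 2c≋q

    ones-unfold : ∀ x (b′ : Vec Bool k) → ones (unfold (x ∷ b′)) ≡ 𝟙 x + (ones b′ + ones b′)
    ones-unfold x b′ = begin
        ones (unfold b)                                  ≡⟨ ones-tabulate N (λ i → mirror b (i + d)) ⟩
        sumBelow N (λ i → 𝟙 (mirror b (i + d)))          ≡⟨ sumBelow-period N (λ i → 𝟙 (mirror b i)) periodic d ⟩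
        sumBelow N (λ i → 𝟙 (mirror b i))                ≡⟨ ones-mirror x b′ ⟩
        𝟙 x + (ones b′ + ones b′)                        ∎
      where
      open ≡-Reasoning
      b : Vec Bool (suc k)
      b = x ∷ b′
      periodic : ∀ i → 𝟙 (mirror b (i + N)) ≡ 𝟙 (mirror b i)
      periodic i = cong 𝟙 (mirror-≋ b (≋-N i))

nz-false : ∀ {m} (v : Vec Bool m) → nz v ≡ false → ∀ x → at v x ≡ false
nz-false []          _  x       = refl
nz-false (false ∷ v) nz zero    = refl
nz-false (false ∷ v) nz (suc x) = nz-false v nz x

nz-true : ∀ {m} (v : Vec Bool m) → nz v ≡ true → ∃ λ x → x < m × at v x ≡ true
nz-true (true ∷ v)  _  = 0 , s≤s z≤n , refl
nz-true (false ∷ v) nz with nz-true v nz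
... | x , x<m , one = suc x , s≤s x<m , one

module Goodness (A B : ℕ) (A≤B : A ≤ B) (B≤1+A : B ≤ suc A) (1≤B : 1 ≤ B) where

  k : ℕ
  k = A + B

  open Folding k
  open Badness (k + k)

  MirrorRun : Vec Bool (suc k) → ℕ → Set
  MirrorRun b s = ∀ {j} → j < k → mirror b (s + j) ≡ false

  A<k : A < k
  A<k = subst (_≤ A + B) (+-comm A 1) (+-monoʳ-≤ A 1≤B)

  -- If b vanishes on [0, A], mirror b vanishes on the k positions N - A, …, N + B - 1.
  low-zero-run : ∀ b → (∀ {x} → x ≤ A → at b x ≡ false) → MirrorRun b (suc (B + k))
  low-zero-run b low-zero {j} j<k with j <? A
  ... | yes j<A = trans (mirror-opposite b (suc (B + k) + j) (A ∸ j) opposite) (trans (mirror-small b (≤-trans A∸j≤A (<⇒≤ A<k))) (low-zero A∸j≤A))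
    where
    A∸j≤A : A ∸ j ≤ A
    A∸j≤A = m∸n≤m A j
    shape : ∀ A B → B + (A + B) + A ≡ (A + B) + (A + B)
    shape = solve-∀
    opposite : suc (B + k) + j + (A ∸ j) ≡ N
    opposite = begin
      suc (B + k) + j + (A ∸ j)      ≡⟨ +-assoc (suc (B + k)) j (A ∸ j) ⟩
      suc (B + k) + (j + (A ∸ j))    ≡⟨ cong (suc (B + k) +_) (m+[n∸m]≡n (<⇒≤ j<A)) ⟩
      suc (B + k + A)                ≡⟨ cong suc (shape A B) ⟩
      N                              ∎
      where open ≡-Reasoning
  ... | no  j≮A = trans (mirror-≋ b wrap) (trans (mirror-small b (≤-trans t≤A (<⇒≤ A<k))) (low-zero t≤A))
    where
    t : ℕ
    t = j ∸ A
    A+t≡j : A + t ≡ j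
    A+t≡j = m+[n∸m]≡n (≮⇒≥ j≮A)
    t≤A : t ≤ A
    t≤A = <⇒≤pred (≤-trans (+-cancelˡ-< A t B (subst (_< A + B) (sym A+t≡j) j<k)) B≤1+A)
    shape : ∀ A B t → suc (B + (A + B)) + (A + t) ≡ t + suc ((A + B) + (A + B))
    shape = solve-∀
    wrap : suc (B + k) + j ≋ t
    wrap = ≋-trans (≡⇒≋ (trans (cong (suc (B + k) +_) (sym A+t≡j)) (shape A B t))) (≋-N t)

  high-zero-run : ∀ b → (∀ {y} → A < y → y ≤ k → at b y ≡ false) → MirrorRun b (suc A)
  high-zero-run b high-zero {j} j<k with suc A + j ≤? k
  ... | yes P≤k = trans (mirror-small b P≤k) (high-zero (s≤s (m≤m+n A j)) P≤k)
  ... | no  P≰k = trans (mirror-opposite b P v P+v≡N) (trans (mirror-small b v≤k) (high-zero A<v v≤k))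
    where
    open ≤-Reasoning
    P : ℕ
    P = suc A + j
    P≤A+k : P ≤ A + k
    P≤A+k = subst (_≤ A + k) (+-suc A j) (+-monoʳ-≤ A j<k)
    A+A≤k : A + A ≤ k
    A+A≤k = +-monoʳ-≤ A A≤B
    A+P≤k+k : A + P ≤ k + k
    A+P≤k+k = begin
      A + P          ≤⟨ +-monoʳ-≤ A P≤A+k ⟩
      A + (A + k)    ≡⟨ +-assoc A A k ⟨
      A + A + k      ≤⟨ +-monoˡ-≤ k A+A≤k ⟩
      k + k          ∎
    v : ℕ
    v = N ∸ P
    P+v≡N : P + v ≡ N
    P+v≡N = m+[n∸m]≡n (≤-trans (n≤1+n P) (s≤s (m+n≤o⇒n≤o A A+P≤k+k)))
    v≤k : v ≤ k
    v≤k = m≤n+o⇒m∸n≤o N P (+-monoˡ-≤ k (≰⇒> P≰k))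
    A<v : A < v
    A<v = m+n≤o⇒m≤o∸n (suc A) (s≤s A+P≤k+k)

  hit : ∀ b {s P} → s ≤ P → P < s + k → mirror b P ≡ true → ¬ MirrorRun b s
  hit b {s} {P} s≤P P<s+k one run = false≢true (trans (sym (run j<k)) (trans (cong (mirror b) s+j≡P) one))
    where
    s+j≡P : s + (P ∸ s) ≡ P
    s+j≡P = m+[n∸m]≡n s≤P
    j<k : P ∸ s < k
    j<k = +-cancelˡ-< s (P ∸ s) k (subst (_< s + k) (sym s+j≡P) P<s+k)

  gap : ∀ b {p s P} → p < s → s ≤ P → P ≤ p + k → mirror b P ≡ true → ¬ MirrorRun b s
  gap b p<s s≤P P≤p+k = hit b s≤P (≤-<-trans P≤p+k (+-monoˡ-< k p<s))

  -- If b has a 1 at some x ≤ A and at some y ∈ (A, k], then mirror b has 1s at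
  -- x < y < N - y < N - x < N + x, consecutive ones at most k apart: no run of k zeros fits.
  module TwoOnes (b : Vec Bool (suc k)) {x y : ℕ} (x≤A : x ≤ A) (one-x : at b x ≡ true)
                 (A<y : A < y) (y≤k : y ≤ k) (one-y : at b y ≡ true) where
    open ≤-Reasoning

    x≤k : x ≤ k
    x≤k = ≤-trans x≤A (<⇒≤ A<k)

    k≤N : k ≤ N
    k≤N = ≤-trans (m≤m+n k k) (n≤1+n (k + k))

    one-at-x : mirror b x ≡ true
    one-at-x = trans (mirror-small b x≤k) one-x

    one-at-y : mirror b y ≡ true
    one-at-y = trans (mirror-small b y≤k) one-y

    one-at-N∸y : mirror b (N ∸ y) ≡ true
    one-at-N∸y = trans (sym (mirror-opposite b y (N ∸ y) (m+[n∸m]≡n (≤-trans y≤k k≤N)))) one-at-y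

    one-at-N∸x : mirror b (N ∸ x) ≡ true
    one-at-N∸x = trans (sym (mirror-opposite b x (N ∸ x) (m+[n∸m]≡n (≤-trans x≤k k≤N)))) one-at-x

    one-at-N+x : mirror b (N + x) ≡ true
    one-at-N+x = trans (mirror-≋ b (≋-trans (≡⇒≋ (+-comm N x)) (≋-N x))) one-at-x

    y≤x+k : y ≤ x + k
    y≤x+k = ≤-trans y≤k (m≤n+m k x)

    N∸y≤y+k : N ∸ y ≤ y + k
    N∸y≤y+k = m≤n+o⇒m∸n≤o N y (begin
      suc (A + B) + k        ≤⟨ +-monoˡ-≤ k (s≤s (+-monoʳ-≤ A B≤1+A)) ⟩
      suc A + suc A + k      ≤⟨ +-monoˡ-≤ k (+-mono-≤ A<y A<y) ⟩
      y + y + k              ≡⟨ +-assoc y y k ⟩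
      y + (y + k)            ∎)

    N∸x≤N∸y+k : N ∸ x ≤ (N ∸ y) + k
    N∸x≤N∸y+k = m≤n+o⇒m∸n≤o N x (begin
      N                      ≡⟨ m+[n∸m]≡n (≤-trans y≤k k≤N) ⟨
      y + (N ∸ y)            ≤⟨ +-monoˡ-≤ (N ∸ y) y≤x+k ⟩
      x + k + (N ∸ y)        ≡⟨ swap x k (N ∸ y) ⟩
      x + ((N ∸ y) + k)      ∎)
      where
      swap : ∀ x k z → x + k + z ≡ x + (z + k)
      swap = solve-∀

    N+x≤N∸x+k : N + x ≤ (N ∸ x) + k
    N+x≤N∸x+k = begin
      N + x                  ≡⟨ cong (_+ x) (m+[n∸m]≡n (≤-trans x≤k k≤N)) ⟨
      x + (N ∸ x) + x        ≡⟨ swap x (N ∸ x) ⟩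
      (N ∸ x) + (x + x)      ≤⟨ +-monoʳ-≤ (N ∸ x) (≤-trans (+-mono-≤ x≤A x≤A) (+-monoʳ-≤ A A≤B)) ⟩
      (N ∸ x) + k            ∎
      where
      swap : ∀ x z → x + z + x ≡ z + (x + x)
      swap = solve-∀

    -- a run starting at s < N is caught by the first of these ones at or after s
    blocked : ∀ {s} → s < N → ¬ MirrorRun b s
    blocked {s} s<N with s ≤? x
    ... | yes s≤x = hit b s≤x (≤-trans (s≤s x≤A) (≤-trans A<k (m≤n+m k s))) one-at-x
    ... | no  s≰x with s ≤? y
    ... | yes s≤y = gap b (≰⇒> s≰x) s≤y y≤x+k one-at-y
    ... | no  s≰y with s ≤? N ∸ y
    ... | yes s≤N∸y = gap b (≰⇒> s≰y) s≤N∸y N∸y≤y+k one-at-N∸y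
    ... | no  s≰N∸y with s ≤? N ∸ x
    ... | yes s≤N∸x = gap b (≰⇒> s≰N∸y) s≤N∸x N∸x≤N∸y+k one-at-N∸x
    ... | no  s≰N∸x = gap b (≰⇒> s≰N∸x) (≤-trans (<⇒≤ s<N) (m≤m+n N x)) N+x≤N∸x+k one-at-N+x

    no-run : ∀ s → ¬ MirrorRun b s
    no-run s run = blocked (m%n<n s N) (λ j<k → trans (mirror-≋ b (≋-+ʳ _ (≋-% s))) (run j<k))

  1≤L : 1 ≤ badLen N
  1≤L = subst (1 ≤_) (sym (badLen-odd k)) (≤-trans 1≤B (m≤n+m B A))

  L≤N : badLen N ≤ N
  L≤N = subst (_≤ N) (sym (badLen-odd k)) (≤-trans (m≤m+n k k) (n≤1+n (k + k)))

  module Unfolded (q : Fin N) (c d : ℕ) (c+d≡N : c + d ≡ N) (2c≋q : c + c ≋ toℕ q) where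
    open Reflection q c d c+d≡N 2c≋q

    unfold-run⇒mirror-run : ∀ b s → ZeroRun (unfold b) s k → MirrorRun b (s + d)
    unfold-run⇒mirror-run b s run {j} j<k =
      trans (cong (mirror b) (swap s d j)) (trans (sym (cyc-unfold b (s + j))) (run j<k))
      where
      swap : ∀ s d j → s + d + j ≡ s + j + d
      swap = solve-∀

    mirror-run⇒unfold-run : ∀ b s → MirrorRun b s → ZeroRun (unfold b) (s + c) k
    mirror-run⇒unfold-run b s run {j} j<k = trans (cyc-unfold b (s + c + j)) (trans (mirror-≋ b once-around) (run j<k))
      where
      open ≋-Reasoning
      rearrange : ∀ s c j d → s + c + j + d ≡ s + j + (c + d)
      rearrange = solve-∀
      once-around : s + c + j + d ≋ s + j
      once-around = begin
        s + c + j + d      ≡⟨ rearrange s c j d ⟩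
        s + j + (c + d)    ≡⟨ cong (s + j +_) c+d≡N ⟩
        s + j + N          ≈⟨ ≋-N (s + j) ⟩
        s + j              ∎

    unfold-bad : ∀ b s → MirrorRun b s → isGood (unfold b) ≡ false
    unfold-bad b s run = cong not (to T-≡ (run⇒bad (unfold b) (s + c) 1≤L
      (subst (ZeroRun (unfold b) (s + c)) (sym (badLen-odd k)) (mirror-run⇒unfold-run b s run))))

    good-unfold : ∀ (u : Vec Bool (suc A)) (w : Vec Bool B) → isGood (unfold (u ++ w)) ≡ nz u ∧ nz w
    good-unfold u w with nz u in nz-u | nz w in nz-w
    ... | false | _ = unfold-bad (u ++ w) (suc (B + k)) (low-zero-run (u ++ w) low-zero)
      where
      low-zero : ∀ {x} → x ≤ A → at (u ++ w) x ≡ false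
      low-zero {x} x≤A = trans (at-++ˡ u w (s≤s x≤A)) (nz-false u nz-u x)
    ... | true | false = unfold-bad (u ++ w) (suc A) (high-zero-run (u ++ w) high-zero)
      where
      high-zero : ∀ {y} → A < y → y ≤ k → at (u ++ w) y ≡ false
      high-zero {y} A<y _ = trans (cong (at (u ++ w)) (sym (m+[n∸m]≡n A<y))) (trans (at-++ʳ u w (y ∸ suc A)) (nz-false w nz-w _))
    ... | true | true with isBad (unfold (u ++ w)) in bad
    ... | false = refl
    ... | true with bad⇒run (unfold (u ++ w)) L≤N (from T-≡ bad) | nz-true u nz-u | nz-true w nz-w
    ... | s , run | x , x<1+A , one-x | t , t<B , one-t =
      ⊥-elim (TwoOnes.no-run (u ++ w) (<⇒≤pred x<1+A) (trans (at-++ˡ u w x<1+A) one-x)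
                (s≤s (m≤m+n A t)) (subst (_≤ A + B) (+-suc A t) (+-monoʳ-≤ A t<B)) (trans (at-++ʳ u w t) one-t)
                (s + d) (unfold-run⇒mirror-run (u ++ w) s (subst (ZeroRun (unfold (u ++ w)) s) (badLen-odd k) run)))

∑-split-zero : ∀ n (h : ℕ → ℕ) → ∑ n (λ u → 𝟙 (nz u) * h (ones u)) + h 0 ≡ ∑ n (λ u → h (ones u))
∑-split-zero zero    h = refl
∑-split-zero (suc n) h = begin
    ∑ n (λ u → 𝟙 (nz u) * h (ones u)) + ∑ n (λ u → h (suc (ones u)) + 0) + h 0
  ≡⟨ cong (λ z → ∑ n (λ u → 𝟙 (nz u) * h (ones u)) + z + h 0) (∑-cong n (λ u → +-identityʳ (h (suc (ones u))))) ⟩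
    ∑ n (λ u → 𝟙 (nz u) * h (ones u)) + ∑ n (λ u → h (suc (ones u))) + h 0
  ≡⟨ +-assoc (∑ n (λ u → 𝟙 (nz u) * h (ones u))) _ (h 0) ⟩
    ∑ n (λ u → 𝟙 (nz u) * h (ones u)) + (∑ n (λ u → h (suc (ones u))) + h 0)
  ≡⟨ cong (∑ n (λ u → 𝟙 (nz u) * h (ones u)) +_) (+-comm _ (h 0)) ⟩
    ∑ n (λ u → 𝟙 (nz u) * h (ones u)) + (h 0 + ∑ n (λ u → h (suc (ones u))))
  ≡⟨ +-assoc (∑ n (λ u → 𝟙 (nz u) * h (ones u))) (h 0) _ ⟨
    ∑ n (λ u → 𝟙 (nz u) * h (ones u)) + h 0 + ∑ n (λ u → h (suc (ones u)))
  ≡⟨ cong (_+ ∑ n (λ u → h (suc (ones u)))) (∑-split-zero n h) ⟩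
    ∑ n (λ u → h (ones u)) + ∑ n (λ u → h (suc (ones u)))
  ∎
  where open ≡-Reasoning

∑-pairs : ∀ p q (f : ℕ → ℕ) → ∑ p (λ u → ∑ q (λ w → f (ones u + ones w))) ≡ ∑ (p + q) (λ v → f (ones v))
∑-pairs p q f = sym (trans (∑-++ p q (λ v → f (ones v)))
                           (∑-cong p (λ u → ∑-cong q (λ w → cong f (ones-++ u w)))))

∑-pairs-nzʳ : ∀ p q (f : ℕ → ℕ) →
  ∑ p (λ u → ∑ q (λ w → 𝟙 (nz w) * f (ones u + ones w))) + ∑ p (λ u → f (ones u)) ≡ ∑ (p + q) (λ v → f (ones v))
∑-pairs-nzʳ p q f = begin
    ∑ p (λ u → ∑ q (λ w → 𝟙 (nz w) * f (ones u + ones w))) + ∑ p (λ u → f (ones u))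
  ≡⟨ ∑-+ p _ _ ⟨
    ∑ p (λ u → ∑ q (λ w → 𝟙 (nz w) * f (ones u + ones w)) + f (ones u))
  ≡⟨ ∑-cong p (λ u → cong (∑ q (λ w → 𝟙 (nz w) * f (ones u + ones w)) +_) (cong f (sym (+-identityʳ (ones u))))) ⟩
    ∑ p (λ u → ∑ q (λ w → 𝟙 (nz w) * f (ones u + ones w)) + f (ones u + 0))
  ≡⟨ ∑-cong p (λ u → ∑-split-zero q (λ t → f (ones u + t))) ⟩
    ∑ p (λ u → ∑ q (λ w → f (ones u + ones w)))
  ≡⟨ ∑-pairs p q f ⟩
    ∑ (p + q) (λ v → f (ones v))
  ∎
  where open ≡-Reasoning

∑-pairs-nz : ∀ p q (f : ℕ → ℕ) →
  ∑ p (λ u → ∑ q (λ w → 𝟙 (nz u ∧ nz w) * f (ones u + ones w))) + ∑ q (λ w → f (ones w)) + ∑ p (λ u → f (ones u))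
    ≡ ∑ (p + q) (λ v → f (ones v)) + f 0
∑-pairs-nz p q f = begin
    ∑ p (λ u → ∑ q (λ w → 𝟙 (nz u ∧ nz w) * f (ones u + ones w))) + ∑ q (λ w → f (ones w)) + Fᵤ
  ≡⟨ cong₂ (λ x y → x + y + Fᵤ) (∑-cong p factor) (sym (∑-split-zero q f)) ⟩
    ∑ p (λ u → 𝟙 (nz u) * H (ones u)) + (H 0 + f 0) + Fᵤ
  ≡⟨ cong (_+ Fᵤ) (sym (+-assoc (∑ p (λ u → 𝟙 (nz u) * H (ones u))) (H 0) (f 0))) ⟩
    ∑ p (λ u → 𝟙 (nz u) * H (ones u)) + H 0 + f 0 + Fᵤ
  ≡⟨ cong (λ x → x + f 0 + Fᵤ) (∑-split-zero p H) ⟩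
    ∑ p (λ u → H (ones u)) + f 0 + Fᵤ
  ≡⟨ +-assoc (∑ p (λ u → H (ones u))) (f 0) Fᵤ ⟩
    ∑ p (λ u → H (ones u)) + (f 0 + Fᵤ)
  ≡⟨ cong (∑ p (λ u → H (ones u)) +_) (+-comm (f 0) Fᵤ) ⟩
    ∑ p (λ u → H (ones u)) + (Fᵤ + f 0)
  ≡⟨ +-assoc (∑ p (λ u → H (ones u))) Fᵤ (f 0) ⟨
    ∑ p (λ u → H (ones u)) + Fᵤ + f 0
  ≡⟨ cong (_+ f 0) (∑-pairs-nzʳ p q f) ⟩
    ∑ (p + q) (λ v → f (ones v)) + f 0
  ∎
  where
  open ≡-Reasoning
  Fᵤ : ℕ
  Fᵤ = ∑ p (λ u → f (ones u))
  H : ℕ → ℕ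
  H t = ∑ q (λ w → 𝟙 (nz w) * f (t + ones w))
  factor : ∀ u → ∑ q (λ w → 𝟙 (nz u ∧ nz w) * f (ones u + ones w)) ≡ 𝟙 (nz u) * H (ones u)
  factor u = trans (∑-cong q (λ w → trans (cong (_* f (ones u + ones w)) (𝟙-∧ (nz u) (nz w)))
                                          (*-assoc (𝟙 (nz u)) (𝟙 (nz w)) _)))
                   (∑-*ˡ q (𝟙 (nz u)) (λ w → 𝟙 (nz w) * f (ones u + ones w)))

double-≡ᵇ : ∀ t j → (t + t ≡ᵇ j + j) ≡ (t ≡ᵇ j)
double-≡ᵇ zero    zero    = refl
double-≡ᵇ zero    (suc j) = refl
double-≡ᵇ (suc t) zero    = refl
double-≡ᵇ (suc t) (suc j) rewrite +-suc t t | +-suc j j = double-≡ᵇ t j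

odd≢ᵇeven : ∀ t j → (suc (t + t) ≡ᵇ j + j) ≡ false
odd≢ᵇeven zero    zero    = refl
odd≢ᵇeven zero    (suc j) rewrite +-suc j j = refl
odd≢ᵇeven (suc t) zero    = refl
odd≢ᵇeven (suc t) (suc j) rewrite +-suc t t | +-suc j j = odd≢ᵇeven t j

even≢ᵇodd : ∀ t j → (t + t ≡ᵇ suc (j + j)) ≡ false
even≢ᵇodd zero    j       = refl
even≢ᵇodd (suc t) zero    rewrite +-suc t t = refl
even≢ᵇodd (suc t) (suc j) rewrite +-suc t t | +-suc j j = even≢ᵇodd t j

module Counting (A B : ℕ) (A≤B : A ≤ B) (B≤1+A : B ≤ suc A) (1≤B : 1 ≤ B) where
  open Goodness A B A≤B B≤1+A 1≤B
  open Folding k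

  module _ (q : Fin N) (c d : ℕ) (c+d≡N : c + d ≡ N) (2c≋q : c + c ≋ toℕ q) where
    open Reflection q c d c+d≡N 2c≋q
    open Unfolded q c d c+d≡N 2c≋q
    open OnesOfUnfolding k using (ones-unfold)

    ∑-fixed : (P : Tuple N → Bool) →
      ∑ N (λ a → 𝟙 (P a ∧ does (fixedDec (ref q) a))) ≡ ∑ (suc k) (λ b → 𝟙 (P (unfold b)))
    ∑-fixed P = trans (∑-retract N (suc k) unfold restrict χ restrict-unfold only-fixed) (∑-cong (suc k) at-unfold)
      where
      χ : Tuple N → ℕ
      χ a = 𝟙 (P a ∧ does (fixedDec (ref q) a))
      only-fixed : ∀ a → χ a ≢ 0 → unfold (restrict a) ≡ a
      only-fixed a χa≢0 with fixedDec (ref q) a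
      ... | yes fixed = fixed⇒unfold-restrict a fixed
      ... | no  _     = ⊥-elim (χa≢0 (cong 𝟙 (∧-zeroʳ (P a))))
      at-unfold : ∀ b → χ (unfold b) ≡ 𝟙 (P (unfold b))
      at-unfold b = cong 𝟙 (trans (cong (P (unfold b) ∧_) (dec-true (fixedDec (ref q) (unfold b)) (unfold-fixed b)))
                                  (∧-identityʳ (P (unfold b))))

    fixG-count : fixG (ref q) ≡ ∑ (suc A) (λ u → 𝟙 (nz u)) * ∑ B (λ w → 𝟙 (nz w))
    fixG-count = begin
        fixG (ref q)                                                 ≡⟨ count-allTuples N _ ⟩
        ∑ N (λ a → 𝟙 (isGood a ∧ does (fixedDec (ref q) a)))         ≡⟨ ∑-fixed isGood ⟩
        ∑ (suc A + B) (λ b → 𝟙 (isGood (unfold b)))                  ≡⟨ ∑-++ (suc A) B (λ b → 𝟙 (isGood (unfold b))) ⟩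
        ∑ (suc A) (λ u → ∑ B (λ w → 𝟙 (isGood (unfold (u ++ w)))))
          ≡⟨ ∑-cong (suc A) (λ u → ∑-cong B (λ w → trans (cong 𝟙 (good-unfold u w)) (𝟙-∧ (nz u) (nz w)))) ⟩
        ∑ (suc A) (λ u → ∑ B (λ w → 𝟙 (nz u) * 𝟙 (nz w)))            ≡⟨ ∑-product (suc A) B (λ u → 𝟙 (nz u)) (λ w → 𝟙 (nz w)) ⟩
        ∑ (suc A) (λ u → 𝟙 (nz u)) * ∑ B (λ w → 𝟙 (nz w))             ∎
      where open ≡-Reasoning

    good-with : ℕ → Bool → Vec Bool A → Vec Bool B → ℕ
    good-with m x u w = 𝟙 ((nz (x ∷ u) ∧ nz w) ∧ (𝟙 x + ((ones u + ones w) + (ones u + ones w)) ≡ᵇ m))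

    fixGm-count : ∀ m → fixGm m (ref q) ≡
      ∑ A (λ u → ∑ B (λ w → good-with m false u w)) + ∑ A (λ u → ∑ B (λ w → good-with m true u w))
    fixGm-count m = begin
        fixGm m (ref q)                                                                ≡⟨ count-allTuples N _ ⟩
        ∑ N (λ a → 𝟙 ((isGood a ∧ (ones a ≡ᵇ m)) ∧ does (fixedDec (ref q) a)))         ≡⟨ ∑-fixed (λ a → isGood a ∧ (ones a ≡ᵇ m)) ⟩
        ∑ (suc (A + B)) (λ b → 𝟙 (isGood (unfold b) ∧ (ones (unfold b) ≡ᵇ m)))
          ≡⟨ cong₂ _+_ (∑-++ A B (λ v → 𝟙 (summand false v))) (∑-++ A B (λ v → 𝟙 (summand true v))) ⟩
        ∑ A (λ u → ∑ B (λ w → 𝟙 (summand false (u ++ w)))) + ∑ A (λ u → ∑ B (λ w → 𝟙 (summand true (u ++ w))))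
          ≡⟨ cong₂ _+_ (∑-cong A (λ u → ∑-cong B (λ w → evaluate false u w)))
                       (∑-cong A (λ u → ∑-cong B (λ w → evaluate true u w))) ⟩
        ∑ A (λ u → ∑ B (λ w → good-with m false u w)) + ∑ A (λ u → ∑ B (λ w → good-with m true u w))  ∎
      where
      open ≡-Reasoning
      summand : Bool → Vec Bool (A + B) → Bool
      summand x v = isGood (unfold (x ∷ v)) ∧ (ones (unfold (x ∷ v)) ≡ᵇ m)
      evaluate : ∀ x u w → 𝟙 (summand x (u ++ w)) ≡ good-with m x u w
      evaluate x u w = cong 𝟙 (cong₂ _∧_ (good-unfold (x ∷ u) w)
        (cong (_≡ᵇ m) (trans (ones-unfold q c d c+d≡N 2c≋q x (u ++ w)) (cong (λ t → 𝟙 x + (t + t)) (ones-++ u w)))))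

    exactly : ℕ → ℕ → ℕ
    exactly j t = 𝟙 (t ≡ᵇ j)

    ∑∑-zero : (f : Vec Bool A → Vec Bool B → ℕ) → (∀ u w → f u w ≡ 0) → ∑ A (λ u → ∑ B (λ w → f u w)) ≡ 0
    ∑∑-zero f f≡0 = trans (∑-cong A (λ u → trans (∑-cong B (f≡0 u)) (∑-zero B))) (∑-zero A)

    -- m = 2j + 1: the middle entry is 1 and the high part is non-zero.
    fixGm-odd : ∀ j → fixGm (suc (j + j)) (ref q) + A C j ≡ k C j
    fixGm-odd j = begin
        fixGm m (ref q) + A C j
      ≡⟨ cong (_+ A C j) (fixGm-count m) ⟩
        ∑ A (λ u → ∑ B (λ w → good-with m false u w)) + ∑ A (λ u → ∑ B (λ w → good-with m true u w)) + A C j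
      ≡⟨ cong₂ (λ x y → x + y + A C j) (∑∑-zero (good-with m false) even-part) (∑-cong A (λ u → ∑-cong B (odd-part u))) ⟩
        ∑ A (λ u → ∑ B (λ w → 𝟙 (nz w) * exactly j (ones u + ones w))) + A C j
      ≡⟨ cong (∑ A (λ u → ∑ B (λ w → 𝟙 (nz w) * exactly j (ones u + ones w))) +_) (sym (∑-ones A j)) ⟩
        ∑ A (λ u → ∑ B (λ w → 𝟙 (nz w) * exactly j (ones u + ones w))) + ∑ A (λ u → exactly j (ones u))
      ≡⟨ ∑-pairs-nzʳ A B (exactly j) ⟩
        ∑ k (λ v → exactly j (ones v))
      ≡⟨ ∑-ones k j ⟩
        k C j
      ∎
      where
      open ≡-Reasoning
      m : ℕ
      m = suc (j + j)
      even-part : ∀ u w → good-with m false u w ≡ 0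
      even-part u w = cong 𝟙 (trans (cong ((nz u ∧ nz w) ∧_) (even≢ᵇodd (ones u + ones w) j)) (∧-zeroʳ _))
      odd-part : ∀ u w → good-with m true u w ≡ 𝟙 (nz w) * exactly j (ones u + ones w)
      odd-part u w = trans (cong (λ z → 𝟙 (nz w ∧ z)) (double-≡ᵇ (ones u + ones w) j)) (𝟙-∧ (nz w) _)

    -- m = 2j ≥ 2: the middle entry is 0 and both parts are non-zero.
    fixGm-even : ∀ j → 1 ≤ j → fixGm (j + j) (ref q) + B C j + A C j ≡ k C j
    fixGm-even j 1≤j = begin
        fixGm m (ref q) + B C j + A C j
      ≡⟨ cong (λ x → x + B C j + A C j) (fixGm-count m) ⟩
        ∑ A (λ u → ∑ B (λ w → good-with m false u w)) + ∑ A (λ u → ∑ B (λ w → good-with m true u w)) + B C j + A C j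
      ≡⟨ cong₂ (λ x y → x + y + B C j + A C j) (∑-cong A (λ u → ∑-cong B (even-part u))) (∑∑-zero (good-with m true) odd-part) ⟩
        ∑ A (λ u → ∑ B (λ w → 𝟙 (nz u ∧ nz w) * exactly j (ones u + ones w))) + 0 + B C j + A C j
      ≡⟨ cong₂ (λ x y → x + y + A C j) (+-identityʳ _) (sym (∑-ones B j)) ⟩
        ∑ A (λ u → ∑ B (λ w → 𝟙 (nz u ∧ nz w) * exactly j (ones u + ones w))) + ∑ B (λ w → exactly j (ones w)) + A C j
      ≡⟨ cong (∑ A (λ u → ∑ B (λ w → 𝟙 (nz u ∧ nz w) * exactly j (ones u + ones w))) + ∑ B (λ w → exactly j (ones w)) +_)
              (sym (∑-ones A j)) ⟩
        ∑ A (λ u → ∑ B (λ w → 𝟙 (nz u ∧ nz w) * exactly j (ones u + ones w))) + ∑ B (λ w → exactly j (ones w))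
          + ∑ A (λ u → exactly j (ones u))
      ≡⟨ ∑-pairs-nz A B (exactly j) ⟩
        ∑ k (λ v → exactly j (ones v)) + exactly j 0
      ≡⟨ cong₂ _+_ (∑-ones k j) (no-empty 1≤j) ⟩
        k C j + 0
      ≡⟨ +-identityʳ (k C j) ⟩
        k C j
      ∎
      where
      open ≡-Reasoning
      m : ℕ
      m = j + j
      even-part : ∀ u w → good-with m false u w ≡ 𝟙 (nz u ∧ nz w) * exactly j (ones u + ones w)
      even-part u w = trans (cong (λ z → 𝟙 ((nz u ∧ nz w) ∧ z)) (double-≡ᵇ (ones u + ones w) j)) (𝟙-∧ (nz u ∧ nz w) _)
      odd-part : ∀ u w → good-with m true u w ≡ 0
      odd-part u w = cong 𝟙 (trans (cong (nz w ∧_) (odd≢ᵇeven (ones u + ones w) j)) (∧-zeroʳ _))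
      no-empty : ∀ {j} → 1 ≤ j → exactly j 0 ≡ 0
      no-empty (s≤s _) = refl

open import Data.Integer using (+_; _-_) renaming (_+_ to _+ℤ_)
import Data.Integer
open import Data.Integer.Properties using (pos-+)
import Data.Integer.Tactic.RingSolver as ℤ-Solver

ℤ-minus₂ : ∀ {a b c d} → a + b + c ≡ d → + a ≡ (+ d - + c) - + b
ℤ-minus₂ {a} {b} {c} {d} a+b+c≡d = begin
    + a                                     ≡⟨ rearrange (+ a) (+ b) (+ c) ⟩
    ((+ a +ℤ + b +ℤ + c) - + c) - + b       ≡⟨ cong (λ z → (z - + c) - + b) (sym (pos-sum a b c)) ⟩
    (+ (a + b + c) - + c) - + b             ≡⟨ cong (λ z → (+ z - + c) - + b) a+b+c≡d ⟩
    (+ d - + c) - + b                       ∎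
  where
  open ≡-Reasoning
  rearrange : ∀ x y z → x ≡ ((x +ℤ y +ℤ z) - z) - y
  rearrange = ℤ-Solver.solve-∀
  pos-sum : ∀ a b c → + (a + b + c) ≡ + a +ℤ + b +ℤ + c
  pos-sum a b c = trans (pos-+ (a + b) c) (cong (_+ℤ + c) (pos-+ a b))

ℤ-minus-plus-one : ∀ {a b c} → a + b ≡ c + 1 → + a ≡ (+ c - + b) +ℤ + 1
ℤ-minus-plus-one {a} {b} {c} a+b≡c+1 = begin
    + a                          ≡⟨ rearrange (+ a) (+ b) ⟩
    (+ a +ℤ + b) - + b           ≡⟨ cong (_- + b) (sym (pos-+ a b)) ⟩
    + (a + b) - + b              ≡⟨ cong (λ z → + z - + b) a+b≡c+1 ⟩
    + (c + 1) - + b              ≡⟨ cong (_- + b) (pos-+ c 1) ⟩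
    (+ c +ℤ + 1) - + b           ≡⟨ swap (+ c) (+ 1) (+ b) ⟩
    (+ c - + b) +ℤ + 1           ∎
  where
  open ≡-Reasoning
  rearrange : ∀ x y → x ≡ (x +ℤ y) - y
  rearrange = ℤ-Solver.solve-∀
  swap : ∀ x o y → (x +ℤ o) - y ≡ (x - y) +ℤ o
  swap = ℤ-Solver.solve-∀

halve : ∀ m → ∃ λ j → m ≡ j + j ⊎ m ≡ suc (j + j)
halve zero = 0 , inj₁ refl
halve (suc m) with halve m
... | j , inj₁ m≡2j   = j , inj₂ (cong suc m≡2j)
... | j , inj₂ m≡2j+1 = suc j , inj₁ (trans (cong suc m≡2j+1) (cong suc (sym (+-suc j j))))

floor-of : ∀ {x} r y d .{{_ : NonZero d}} → r < d → x ≡ r + y * d → x / d ≡ y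
floor-of r y d r<d refl = quotient r y d r<d

residue-of : ∀ {x} r y d .{{_ : NonZero d}} → r < d → x ≡ r + y * d → x % d ≡ r
residue-of r y d r<d refl = remainder r y d r<d

half-even : ∀ j → (j + j) / 2 ≡ j × (j + j) % 2 ≡ 0
half-even j = floor-of 0 j 2 (s≤s z≤n) (shape j) , residue-of 0 j 2 (s≤s z≤n) (shape j)
  where
  shape : ∀ j → j + j ≡ 0 + j * 2
  shape = solve-∀

half-odd : ∀ j → suc (j + j) / 2 ≡ j × suc (j + j) % 2 ≡ 1
half-odd j = floor-of 1 j 2 (s≤s (s≤s z≤n)) (shape j) , residue-of 1 j 2 (s≤s (s≤s z≤n)) (shape j)
  where
  shape : ∀ j → suc (j + j) ≡ 1 + j * 2
  shape = solve-∀

module Reflections (A B : ℕ) (A≤B : A ≤ B) (B≤1+A : B ≤ suc A) (1≤B : 1 ≤ B) where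
  open Counting A B A≤B B≤1+A 1≤B
  open Goodness A B A≤B B≤1+A 1≤B using (k)
  open Folding k using (N; centre)

  fixG-reflection : ∀ q → fixG (ref q) ≡ ∑ (suc A) (λ u → 𝟙 (nz u)) * ∑ B (λ w → 𝟙 (nz w))
  fixG-reflection q with centre (toℕ q)
  ... | c , d , c+d≡N , 2c≋q = fixG-count q c d c+d≡N 2c≋q

  fixGm-reflection : ∀ q {m} → 3 ≤ m → + fixGm m (ref q) ≡ (+ (k C (m / 2)) - + (A C (m / 2))) - + binomHalf B m
  fixGm-reflection q {m} 3≤m with centre (toℕ q) | halve m
  ... | c , d , c+d≡N , 2c≋q | j , inj₁ refl
    rewrite proj₁ (half-even j) | proj₂ (half-even j) = ℤ-minus₂ (fixGm-even q c d c+d≡N 2c≋q j (positive j 3≤m))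
    where
    positive : ∀ j → 3 ≤ j + j → 1 ≤ j
    positive (suc j) _ = s≤s z≤n
  ... | c , d , c+d≡N , 2c≋q | j , inj₂ refl
    rewrite proj₁ (half-odd j) | proj₂ (half-odd j) =
      ℤ-minus₂ (trans (cong (_+ A C j) (+-identityʳ _)) (fixGm-odd q c d c+d≡N 2c≋q j))

  part-ii : N / 2 ≡ k → N / 4 ≡ A → (N + 2) / 4 ≡ B → ∀ q {m} → 3 ≤ m →
    + fixGm m (ref q) ≡ (+ ((N / 2) C (m / 2)) - + ((N / 4) C (m / 2))) - + binomHalf ((N + 2) / 4) m
  part-ii N/2≡k N/4≡A [N+2]/4≡B q 3≤m rewrite N/2≡k | N/4≡A | [N+2]/4≡B = fixGm-reflection q 3≤m

Conclusion : (n : ℕ) → Dihedral n → Set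
Conclusion n σ =
  ((n % 4 ≡ 1 → + fixG σ ≡ (+ (2 ^ ((n + 1) / 2)) - + (3 * 2 ^ ((n ∸ 1) / 4))) +ℤ + 1)
   × (n % 4 ≡ 3 → + fixG σ ≡ (+ (2 ^ ((n + 1) / 2)) - + (2 ^ ((n + 5) / 4))) +ℤ + 1))
  × ((m : ℕ) → 3 ≤ m → m ≤ n →
       + fixGm m σ ≡ (+ ((n / 2) C (m / 2)) - + ((n / 4) C (m / 2))) - + binomHalf ((n + 2) / 4) m)

-- n = 4A + 1 with A ≥ 1, so that B = A.
theorem-1mod4 : ∀ A → 1 ≤ A → (q : Fin (suc ((A + A) + (A + A)))) → Conclusion (suc ((A + A) + (A + A))) (ref q)
theorem-1mod4 A 1≤A q = (part-i , λ n%4≡3 → ⊥-elim (1≢3 (trans (sym n%4≡1) n%4≡3))) , λ m 3≤m _ →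
    part-ii (floor-of 1 (A + A) 2 (s≤s (s≤s z≤n)) (shape₂ A)) (floor-of 1 A 4 (s≤s (s≤s z≤n)) (shape₄ A))
            (floor-of 3 A 4 (s≤s (s≤s (s≤s (s≤s z≤n)))) (shape₄′ A)) q 3≤m
  where
  open Reflections A A ≤-refl (n≤1+n A) 1≤A
  n : ℕ
  n = suc ((A + A) + (A + A))
  shape₂ : ∀ A → suc ((A + A) + (A + A)) ≡ 1 + (A + A) * 2
  shape₂ = solve-∀
  shape₄ : ∀ A → suc ((A + A) + (A + A)) ≡ 1 + A * 4
  shape₄ = solve-∀
  shape₄′ : ∀ A → suc ((A + A) + (A + A)) + 2 ≡ 3 + A * 4
  shape₄′ = solve-∀
  shape₁ : ∀ A → suc ((A + A) + (A + A)) + 1 ≡ 0 + suc (A + A) * 2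
  shape₁ = solve-∀
  shape₀ : ∀ A → (A + A) + (A + A) ≡ 0 + A * 4
  shape₀ = solve-∀
  n%4≡1 : n % 4 ≡ 1
  n%4≡1 = residue-of 1 A 4 (s≤s (s≤s z≤n)) (shape₄ A)
  1≢3 : 1 ≢ 3
  1≢3 ()
  -- with Y = #(non-zero vectors of length A) = 2^A - 1: fix_G = (2Y + 1)·Y = 2^{2A+1} - 3·2^A + 1
  Y : ℕ
  Y = ∑ A (λ u → 𝟙 (nz u))
  count : fixG (ref q) + 3 * 2 ^ A ≡ 2 ^ suc (A + A) + 1
  count = begin
      fixG (ref q) + 3 * 2 ^ A                ≡⟨ cong (_+ 3 * 2 ^ A) (fixG-reflection q) ⟩
      (Y + ∑ A (λ _ → 1)) * Y + 3 * 2 ^ A      ≡⟨ cong (λ p → (Y + p) * Y + 3 * 2 ^ A) (∑-one A) ⟩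
      (Y + 2 ^ A) * Y + 3 * 2 ^ A              ≡⟨ cong (λ p → (Y + p) * Y + 3 * p) (∑-nz A) ⟨
      (Y + (Y + 1)) * Y + 3 * (Y + 1)          ≡⟨ polynomial Y ⟩
      2 * ((Y + 1) * (Y + 1)) + 1              ≡⟨ cong (λ p → 2 * (p * p) + 1) (∑-nz A) ⟩
      2 * (2 ^ A * 2 ^ A) + 1                  ≡⟨ cong (λ z → 2 * z + 1) (^-distribˡ-+-* 2 A A) ⟨
      2 ^ suc (A + A) + 1                      ∎
    where
    open ≡-Reasoning
    polynomial : ∀ Y → (Y + (Y + 1)) * Y + 3 * (Y + 1) ≡ 2 * ((Y + 1) * (Y + 1)) + 1
    polynomial = solve-∀
  part-i : n % 4 ≡ 1 → + fixG (ref q) ≡ (+ (2 ^ ((n + 1) / 2)) - + (3 * 2 ^ ((n ∸ 1) / 4))) +ℤ + 1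
  part-i _ rewrite floor-of 0 (suc (A + A)) 2 (s≤s z≤n) (shape₁ A) | floor-of 0 A 4 (s≤s z≤n) (shape₀ A) =
    ℤ-minus-plus-one count

-- n = 4A + 3, so that B = A + 1.
theorem-3mod4 : ∀ A → (q : Fin (suc ((A + suc A) + (A + suc A)))) → Conclusion (suc ((A + suc A) + (A + suc A))) (ref q)
theorem-3mod4 A q = ((λ n%4≡1 → ⊥-elim (3≢1 (trans (sym n%4≡3) n%4≡1))) , part-i) , λ m 3≤m _ →
    part-ii (floor-of 1 (A + suc A) 2 (s≤s (s≤s z≤n)) (shape₂ A)) (floor-of 3 A 4 (s≤s (s≤s (s≤s (s≤s z≤n)))) (shape₄ A))
            (floor-of 1 (suc A) 4 (s≤s (s≤s z≤n)) (shape₄′ A)) q 3≤m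
  where
  open Reflections A (suc A) (n≤1+n A) ≤-refl (s≤s z≤n)
  n : ℕ
  n = suc ((A + suc A) + (A + suc A))
  shape₂ : ∀ A → suc ((A + suc A) + (A + suc A)) ≡ 1 + (A + suc A) * 2
  shape₂ = solve-∀
  shape₄ : ∀ A → suc ((A + suc A) + (A + suc A)) ≡ 3 + A * 4
  shape₄ = solve-∀
  shape₄′ : ∀ A → suc ((A + suc A) + (A + suc A)) + 2 ≡ 1 + suc A * 4
  shape₄′ = solve-∀
  shape₁ : ∀ A → suc ((A + suc A) + (A + suc A)) + 1 ≡ 0 + suc (suc (A + A)) * 2
  shape₁ = solve-∀
  shape₅ : ∀ A → suc ((A + suc A) + (A + suc A)) + 5 ≡ 0 + suc (suc A) * 4
  shape₅ = solve-∀
  n%4≡3 : n % 4 ≡ 3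
  n%4≡3 = residue-of 3 A 4 (s≤s (s≤s (s≤s (s≤s z≤n)))) (shape₄ A)
  3≢1 : 3 ≢ 1
  3≢1 ()
  -- with Y = 2^A - 1: fix_G = (2Y + 1)² = 2^{2A+2} - 2^{A+2} + 1
  Y : ℕ
  Y = ∑ A (λ u → 𝟙 (nz u))
  count : fixG (ref q) + 2 ^ suc (suc A) ≡ 2 ^ suc (suc (A + A)) + 1
  count = begin
      fixG (ref q) + 2 * (2 * 2 ^ A)                                 ≡⟨ cong (_+ 2 * (2 * 2 ^ A)) (fixG-reflection q) ⟩
      (Y + ∑ A (λ _ → 1)) * (Y + ∑ A (λ _ → 1)) + 2 * (2 * 2 ^ A)     ≡⟨ cong (λ p → (Y + p) * (Y + p) + 2 * (2 * 2 ^ A)) (∑-one A) ⟩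
      (Y + 2 ^ A) * (Y + 2 ^ A) + 2 * (2 * 2 ^ A)                     ≡⟨ cong (λ p → (Y + p) * (Y + p) + 2 * (2 * p)) (∑-nz A) ⟨
      (Y + (Y + 1)) * (Y + (Y + 1)) + 2 * (2 * (Y + 1))              ≡⟨ polynomial Y ⟩
      2 * (2 * ((Y + 1) * (Y + 1))) + 1                              ≡⟨ cong (λ p → 2 * (2 * (p * p)) + 1) (∑-nz A) ⟩
      2 * (2 * (2 ^ A * 2 ^ A)) + 1                                  ≡⟨ cong (λ z → 2 * (2 * z) + 1) (^-distribˡ-+-* 2 A A) ⟨
      2 ^ suc (suc (A + A)) + 1                                      ∎
    where
    open ≡-Reasoning
    polynomial : ∀ Y → (Y + (Y + 1)) * (Y + (Y + 1)) + 2 * (2 * (Y + 1)) ≡ 2 * (2 * ((Y + 1) * (Y + 1))) + 1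
    polynomial = solve-∀
  part-i : n % 4 ≡ 3 → + fixG (ref q) ≡ (+ (2 ^ ((n + 1) / 2)) - + (2 ^ ((n + 5) / 4))) +ℤ + 1
  part-i _ rewrite floor-of 0 (suc (suc (A + A))) 2 (s≤s z≤n) (shape₁ A) | floor-of 0 (suc (suc A)) 4 (s≤s z≤n) (shape₅ A) =
    ℤ-minus-plus-one count

odd-shape : ∀ n → 3 ≤ n → n % 2 ≡ 1 →
  (∃ λ A → 1 ≤ A × n ≡ suc ((A + A) + (A + A))) ⊎ (∃ λ A → n ≡ suc ((A + suc A) + (A + suc A)))
odd-shape n 3≤n n-odd with halve n
... | k , inj₁ refl = ⊥-elim (0≢1 (trans (sym (proj₂ (half-even k))) n-odd))
  where
  0≢1 : 0 ≢ 1
  0≢1 ()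
... | k , inj₂ refl with halve k
... | A , inj₁ refl = inj₁ (A , positive A 3≤n , refl)
  where
  positive : ∀ A → 3 ≤ suc ((A + A) + (A + A)) → 1 ≤ A
  positive zero    (s≤s ())
  positive (suc A) _ = s≤s z≤n
... | A , inj₂ refl = inj₂ (A , cong suc (cong₂ _+_ (sym (+-suc A A)) (sym (+-suc A A))))

lemma3p3 : (n : ℕ) → 3 ≤ n → n % 2 ≡ 1 → (σ : Dihedral n) → IsReflection σ →
  ((n % 4 ≡ 1 → + fixG σ ≡ (+ (2 ^ ((n + 1) / 2)) - + (3 * 2 ^ ((n ∸ 1) / 4))) Data.Integer.+ + 1)
   × (n % 4 ≡ 3 → + fixG σ ≡ (+ (2 ^ ((n + 1) / 2)) - + (2 ^ ((n + 5) / 4))) Data.Integer.+ + 1))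
  × ((m : ℕ) → 3 ≤ m → m ≤ n →
       + fixGm m σ ≡ (+ ((n / 2) C (m / 2)) - + ((n / 4) C (m / 2))) - + binomHalf ((n + 2) / 4) m)
lemma3p3 n 3≤n n-odd σ (q , refl) with odd-shape n 3≤n n-odd
... | inj₁ (A , 1≤A , refl) = theorem-1mod4 A 1≤A q
... | inj₂ (A , refl)       = theorem-3mod4 A q
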